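{- Let $m$ be a positive integer. For any digraph $D=(V,A)$ there exists a unique polynomial $B^{(m)}_D(q;y_1,\dots,y_m;z_1,\dots,z_m)$ in $2m+1$ variables such that for every non-negative integer $p$, $$B^{(m)}_D(mp+1;y_1,\dots,y_m;z_1,\dots,z_m)=\sum_{f:V\to[mp+1]}\prod_{k=1}^m y_k^{|f^{k}_A|}z_k^{|f^{ -k}_A|},$$ where $f^{k}_A$ (resp. $f^{ -k}_A$) is the set of arcs $(u,v)\in A$ such that $f(v)-f(u)\in\{(k-1)p+1,\dots,kp\}$ (resp. $f(u)-f(v)\in\{(k-1)p+1,\dots,kp\}$).
   Context: Digraphs are finite, loops and multiple arcs allowed. $[N]=\{1,\dots,N\}$. -}

module Defs where

open import Data.Nat as ℕ using (ℕ; zero; suc; _<_; _≤_; _∸_; _<?_; _≤?_)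
open import Data.Fin using (Fin; toℕ)
import Data.Vec as V
open import Data.Vec using (Vec)
import Data.Vec.Properties as VP
open import Data.List using (List; []; _∷_; map; filter; length; concatMap)
open import Data.Product using (_×_; _,_)
open import Data.Integer using (+_)
open import Data.Rational using (ℚ; _/_; 0ℚ; 1ℚ; _+_; _*_)
open import Relation.Nullary using (Dec; yes; no)
open import Relation.Nullary.Decidable using (_×-dec_)
open import Relation.Binary.PropositionalEquality using (_≡_)

-- Digraphs: vertex set [n] (modelled as Fin n), arcs given as a list of
-- ordered pairs (tail , head); loops and repeated arcs are allowed.

record Digraph : Set where
  constructor digraph
  field
    nV   : ℕ
    arcs : List (Fin nV × Fin nV)
open Digraph public

-- The monomial q^i y_1^a_1..y_m^a_m z_1^b_1..z_m^b_m
-- is represented by its exponent data (i , a , b).  A polynomial is a finite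
-- list of (coefficient , monomial) terms, read as their sum.

Mono : ℕ → Set
Mono m = ℕ × Vec ℕ m × Vec ℕ m

Poly : ℕ → Set
Poly m = List (ℚ × Mono m)

_≟V_ : ∀ {m} (a b : Vec ℕ m) → Dec (a ≡ b)
_≟V_ = VP.≡-dec ℕ._≟_

coeff : ∀ {m} → Poly m → Mono m → ℚ
coeff [] t = 0ℚ
coeff ((c , (i , a , b)) ∷ P) (j , a' , b') with i ℕ.≟ j | a ≟V a' | b ≟V b'
... | yes _ | yes _ | yes _ = c + coeff P (j , a' , b')
... | _     | _     | _     = coeff P (j , a' , b')

_≈P_ : ∀ {m} → Poly m → Poly m → Set
P ≈P Q = ∀ t → coeff P t ≡ coeff Q t

ℕ→ℚ : ℕ → ℚ
ℕ→ℚ n = + n / 1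

_^Q_ : ℚ → ℕ → ℚ
x ^Q zero  = 1ℚ
x ^Q suc n = x * (x ^Q n)

coeffAt : ∀ {m} → Poly m → ℚ → Vec ℕ m → Vec ℕ m → ℚ
coeffAt [] x a' b' = 0ℚ
coeffAt ((c , (i , a , b)) ∷ P) x a' b' with a ≟V a' | b ≟V b'
... | yes _ | yes _ = c * (x ^Q i) + coeffAt P x a' b'
... | _     | _     = coeffAt P x a' b'

allFuns : (n N : ℕ) → List (Vec (Fin N) n)
allFuns zero    N = V.[] ∷ []
allFuns (suc n) N =
  concatMap (λ c → map (λ f → c V.∷ f) (allFuns n N)) (Data.List.allFin N)
  where import Data.List

-- the colour difference condition: (k-1)p < d ≤ kp, for k = toℕ k0 + 1
inBand : ℕ → ℕ → ℕ → Set
inBand p k d = (k ℕ.* p < d) × (d ≤ suc k ℕ.* p)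

inBand? : ∀ p k d → Dec (inBand p k d)
inBand? p k d = (k ℕ.* p <? d) ×-dec (d ≤? suc k ℕ.* p)

module _ (D : Digraph) where
  fPlus : ∀ {N} → ℕ → Vec (Fin N) (nV D) → ℕ → ℕ
  fPlus p f k = length (filter (λ { (u , v) → inBand? p k (toℕ (V.lookup f v) ∸ toℕ (V.lookup f u)) }) (arcs D))

  fMinus : ∀ {N} → ℕ → Vec (Fin N) (nV D) → ℕ → ℕ
  fMinus p f k = length (filter (λ { (u , v) → inBand? p k (toℕ (V.lookup f u) ∸ toℕ (V.lookup f v)) }) (arcs D))

  expPlus : ∀ {N} m → ℕ → Vec (Fin N) (nV D) → Vec ℕ m
  expPlus m p f = V.tabulate (λ k → fPlus p f (toℕ k))

  expMinus : ∀ {N} m → ℕ → Vec (Fin N) (nV D) → Vec ℕ m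
  expMinus m p f = V.tabulate (λ k → fMinus p f (toℕ k))

  countRHS : ∀ m → ℕ → Vec ℕ m → Vec ℕ m → ℕ
  countRHS m p a b =
    length (filter (λ f → (expPlus m p f ≟V a) ×-dec (expMinus m p f ≟V b))
                   (allFuns (nV D) (suc (m ℕ.* p))))

  IsB : ∀ m → Poly m → Set
  IsB m P = ∀ (p : ℕ) (a b : Vec ℕ m) →
    coeffAt P (ℕ→ℚ (suc (m ℕ.* p))) a b ≡ ℕ→ℚ (countRHS m p a b)

-- Split [0, m p] into the colour 0 and the blocks (J p, (J + 1) p], J < m. Once every
-- vertex is assigned a block, whether the colour difference along an arc lies in the
-- k-th band depends only on the blocks and on the order of the offsets within them.
-- The coefficient of y^a z^b is thus a finite sum, over such block assignments, of sums
-- of order-invariant functions over boxes {0}^i × [1, p]^j. Each of those is a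
-- polynomial in p, since its forward difference in p is a sum of the same kind with
-- fewer free coordinates. Writing the binomial basis C(p, k) in the variable
-- q = m p + 1 gives the coefficients of B; uniqueness holds because a polynomial in q
-- is determined by its values at the infinitely many points m p + 1.

module Submission where

open import Data.Bool using (Bool; true; false; _∧_; _∨_; not; if_then_else_)
import Data.Bool.Properties as BoolP
open import Data.Fin as F using (Fin; toℕ)
import Data.Integer as ℤ
import Data.Integer.Properties as ℤP
open import Data.List as L using (List; []; _∷_; _++_)
import Data.List.Properties as LP
open import Data.List.Membership.Propositional.Properties using (∈-applyUpTo⁺)
open import Data.List.Relation.Unary.All as ListAll using (All; []; _∷_)
import Data.List.Relation.Unary.All.Properties as ListAllP
open import Data.Maybe using (Maybe; nothing; just)
open import Data.Nat as ℕ using (ℕ; zero; suc; _<_; _≤_; _≥_; z≤n; s≤s; _<ᵇ_; _≤ᵇ_; _≡ᵇ_; _<?_; _≤?_)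
open import Data.Nat.Divisibility using (∣1⇒≡1)
import Data.Nat.Properties as ℕP
import Data.Nat.Solver as ℕSolver
open import Data.Product using (Σ; _×_; _,_; proj₁; proj₂; uncurry)
import Data.Rational as ℚ
open import Data.Rational using (ℚ; mkℚ; 0ℚ; 1ℚ; 1/_)
import Data.Rational.Properties as ℚP
import Data.Rational.Solver as ℚSolver
open import Data.Sum as Sum using (_⊎_; inj₁; inj₂)
open import Data.Unit using (⊤; tt)
open import Data.Vec as V using (Vec; []; _∷_)
import Data.Vec.Properties as VecP
open import Data.Vec.Relation.Unary.All as VecAll using ([]; _∷_)
import Data.Vec.Relation.Unary.All.Properties as VecAllP
open import Function using (_∘_; _∘′_; flip)
open import Relation.Binary.Definitions using (tri<; tri≈; tri>)
open import Relation.Binary.PropositionalEquality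
open import Relation.Nullary using (Dec; yes; no; does; ¬_; contradiction)
open import Relation.Nullary.Decidable using (dec-true; dec-false; _×-dec_)
open import Defs

open import Algebra.Properties.CommutativeSemigroup ℕP.+-commutativeSemigroup using (interchange)
open import Algebra.Properties.Group ℚP.+-0-group using (x∙y⁻¹≈ε⇒x≈y)

module Counting where

  open import Data.Nat using (_+_; _*_; _∸_)

  sumBelow : ℕ → (ℕ → ℕ) → ℕ
  sumBelow zero    h = 0
  sumBelow (suc n) h = h 0 + sumBelow n (h ∘ suc)

  sumBelow-cong< : ∀ n {h h′ : ℕ → ℕ} → (∀ i → i < n → h i ≡ h′ i) → sumBelow n h ≡ sumBelow n h′
  sumBelow-cong< zero    eq = refl
  sumBelow-cong< (suc n) eq = cong₂ _+_ (eq 0 (s≤s z≤n)) (sumBelow-cong< n (λ i → eq (suc i) ∘ s≤s))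

  sumBelow-cong : ∀ n {h h′ : ℕ → ℕ} → (∀ i → h i ≡ h′ i) → sumBelow n h ≡ sumBelow n h′
  sumBelow-cong n eq = sumBelow-cong< n (λ i _ → eq i)

  sumBelow-zero : ∀ n → sumBelow n (λ _ → 0) ≡ 0
  sumBelow-zero zero    = refl
  sumBelow-zero (suc n) = sumBelow-zero n

  sumBelow-distrib : ∀ n (g h : ℕ → ℕ) → sumBelow n (λ i → g i + h i) ≡ sumBelow n g + sumBelow n h
  sumBelow-distrib zero    g h = refl
  sumBelow-distrib (suc n) g h =
    trans (cong (g 0 + h 0 +_) (sumBelow-distrib n (g ∘ suc) (h ∘ suc))) (interchange (g 0) (h 0) _ _)

  sumBelow-suc : ∀ n h → sumBelow (suc n) h ≡ sumBelow n h + h n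
  sumBelow-suc zero    h = ℕP.+-comm (h 0) 0
  sumBelow-suc (suc n) h = trans (cong (h 0 +_) (sumBelow-suc n (h ∘ suc))) (sym (ℕP.+-assoc (h 0) _ _))

  sumBelow-+ : ∀ a b h → sumBelow (a + b) h ≡ sumBelow a h + sumBelow b (λ i → h (a + i))
  sumBelow-+ zero    b h = refl
  sumBelow-+ (suc a) b h = trans (cong (h 0 +_) (sumBelow-+ a b (h ∘ suc))) (sym (ℕP.+-assoc (h 0) _ _))

  sumBelow-* : ∀ m p h → sumBelow (m * p) h ≡ sumBelow m (λ J → sumBelow p (λ i → h (J * p + i)))
  sumBelow-* zero    p h = refl
  sumBelow-* (suc m) p h = trans (sumBelow-+ p (m * p) h) (cong (sumBelow p h +_)
    (trans (sumBelow-* m p (λ i → h (p + i)))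
           (sumBelow-cong m (λ J → sumBelow-cong p (λ i → cong h (sym (ℕP.+-assoc p (J * p) i)))))))

  sumBelow-comm : ∀ a b (h : ℕ → ℕ → ℕ) →
    sumBelow a (λ i → sumBelow b (h i)) ≡ sumBelow b (λ j → sumBelow a (λ i → h i j))
  sumBelow-comm zero    b h = sym (sumBelow-zero b)
  sumBelow-comm (suc a) b h = trans (cong (sumBelow b (h 0) +_) (sumBelow-comm a b (h ∘ suc)))
    (sym (sumBelow-distrib b (h 0) _))

  sumOver : ∀ {A : Set} → List A → (A → ℕ) → ℕ
  sumOver []       h = 0
  sumOver (x ∷ xs) h = h x + sumOver xs h

  module _ {A : Set} where

    sumOver-cong : ∀ xs {g h : A → ℕ} → (∀ x → g x ≡ h x) → sumOver xs g ≡ sumOver xs h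
    sumOver-cong []       eq = refl
    sumOver-cong (x ∷ xs) eq = cong₂ _+_ (eq x) (sumOver-cong xs eq)

    sumOver-++ : ∀ (xs ys : List A) h → sumOver (xs ++ ys) h ≡ sumOver xs h + sumOver ys h
    sumOver-++ []       ys h = refl
    sumOver-++ (x ∷ xs) ys h = trans (cong (h x +_) (sumOver-++ xs ys h)) (sym (ℕP.+-assoc (h x) _ _))

    sumOver-map : ∀ {B : Set} (f : B → A) xs h → sumOver (L.map f xs) h ≡ sumOver xs (h ∘ f)
    sumOver-map f []       h = refl
    sumOver-map f (x ∷ xs) h = cong (h (f x) +_) (sumOver-map f xs h)

    sumOver-concatMap : ∀ {B : Set} (f : B → List A) xs h →
      sumOver (L.concatMap f xs) h ≡ sumOver xs (λ x → sumOver (f x) h)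
    sumOver-concatMap f []       h = refl
    sumOver-concatMap f (x ∷ xs) h =
      trans (sumOver-++ (f x) (L.concatMap f xs) h) (cong (sumOver (f x) h +_) (sumOver-concatMap f xs h))

    sumOver-sumBelow-comm : ∀ xs p (h : A → ℕ → ℕ) →
      sumOver xs (λ x → sumBelow p (h x)) ≡ sumBelow p (λ i → sumOver xs (λ x → h x i))
    sumOver-sumBelow-comm []       p h = sym (sumBelow-zero p)
    sumOver-sumBelow-comm (x ∷ xs) p h =
      trans (cong (sumBelow p (h x) +_) (sumOver-sumBelow-comm xs p h)) (sym (sumBelow-distrib p (h x) _))

    sumOver-tabulate : ∀ n (f : Fin n → A) {g : A → ℕ} {h : ℕ → ℕ} → (∀ i → g (f i) ≡ h (toℕ i)) →
      sumOver (L.tabulate f) g ≡ sumBelow n h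
    sumOver-tabulate zero    f eq = refl
    sumOver-tabulate (suc n) f eq = cong₂ _+_ (eq F.zero) (sumOver-tabulate n (f ∘ F.suc) (eq ∘ F.suc))

  -- A box is a product of intervals [s, s + l), each given as (s , l).
  sumBox : ∀ {n} → Vec (ℕ × ℕ) n → (Vec ℕ n → ℕ) → ℕ
  sumBox []             G = G []
  sumBox ((s , l) ∷ rs) G = sumBelow l (λ i → sumBox rs (λ t → G (s + i ∷ t)))

  InBox : ∀ {n} → Vec (ℕ × ℕ) n → Vec ℕ n → Set
  InBox []             []      = ⊤
  InBox ((s , l) ∷ rs) (x ∷ t) = (s ≤ x × x < s + l) × InBox rs t

  sumBox-congᵢ : ∀ {n} (rs : Vec (ℕ × ℕ) n) {G G′ : Vec ℕ n → ℕ} →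
    (∀ t → InBox rs t → G t ≡ G′ t) → sumBox rs G ≡ sumBox rs G′
  sumBox-congᵢ []             eq = eq [] tt
  sumBox-congᵢ ((s , l) ∷ rs) eq = sumBelow-cong< l (λ i i<l → sumBox-congᵢ rs (λ t t∈rs →
    eq (s + i ∷ t) ((ℕP.m≤m+n s i , ℕP.+-monoʳ-< s i<l) , t∈rs)))

  sumBox-cong : ∀ {n} (rs : Vec (ℕ × ℕ) n) {G G′ : Vec ℕ n → ℕ} → (∀ t → G t ≡ G′ t) → sumBox rs G ≡ sumBox rs G′
  sumBox-cong rs eq = sumBox-congᵢ rs (λ t _ → eq t)

  sumBox-singleton : ∀ {n} s (rs : Vec (ℕ × ℕ) n) G → sumBox ((s , 1) ∷ rs) G ≡ sumBox rs (λ t → G (s ∷ t))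
  sumBox-singleton s rs G =
    trans (ℕP.+-identityʳ _) (sumBox-cong rs (λ t → cong (λ x → G (x ∷ t)) (ℕP.+-identityʳ s)))

  indicator : Bool → ℕ
  indicator true  = 1
  indicator false = 0

  length-filter≡sumOver : ∀ {A : Set} {P : A → Set} (P? : ∀ x → Dec (P x)) xs →
    L.length (L.filter P? xs) ≡ sumOver xs (indicator ∘ does ∘ P?)
  length-filter≡sumOver P? []       = refl
  length-filter≡sumOver P? (x ∷ xs) with does (P? x)
  ... | true  = cong suc (length-filter≡sumOver P? xs)
  ... | false = length-filter≡sumOver P? xs

  sumOver-allFuns : ∀ n N (G : Vec ℕ n → ℕ) →
    sumOver (allFuns n N) (G ∘ V.map toℕ) ≡ sumBox (V.replicate n (0 , N)) G
  sumOver-allFuns zero    N G = ℕP.+-identityʳ (G [])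
  sumOver-allFuns (suc n) N G =
    trans (sumOver-concatMap (λ c → L.map (c ∷_) (allFuns n N)) (L.allFin N) (G ∘ V.map toℕ))
          (sumOver-tabulate N (λ c → c) (λ c →
            trans (sumOver-map (c ∷_) (allFuns n N) (G ∘ V.map toℕ)) (sumOver-allFuns n N (G ∘ (toℕ c ∷_)))))

  -- Colours in blocks

  -- `nothing` stands for the colour 0 and `just J` for the block J p < x ≤ (J + 1) p.
  blockBase : Maybe ℕ → ℕ
  blockBase nothing  = 0
  blockBase (just J) = J

  blockRange : ℕ → Maybe ℕ → ℕ × ℕ
  blockRange p nothing  = (0 , 1)
  blockRange p (just _) = (1 , p)

  sumBlocks : (n m : ℕ) → (Vec (Maybe ℕ) n → ℕ) → ℕ
  sumBlocks zero    m H = H []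
  sumBlocks (suc n) m H =
    sumBlocks n m (H ∘ (nothing ∷_)) + sumBelow m (λ J → sumBlocks n m (H ∘ (just J ∷_)))

  sumBlocks-cong : ∀ n m {H H′ : Vec (Maybe ℕ) n → ℕ} → (∀ σ → H σ ≡ H′ σ) → sumBlocks n m H ≡ sumBlocks n m H′
  sumBlocks-cong zero    m eq = eq []
  sumBlocks-cong (suc n) m eq = cong₂ _+_ (sumBlocks-cong n m (eq ∘ (nothing ∷_)))
    (sumBelow-cong m (λ J → sumBlocks-cong n m (eq ∘ (just J ∷_))))

  sumBlocks-sumBelow-comm : ∀ n m p (H : Vec (Maybe ℕ) n → ℕ → ℕ) →
    sumBlocks n m (λ σ → sumBelow p (H σ)) ≡ sumBelow p (λ i → sumBlocks n m (λ σ → H σ i))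
  sumBlocks-sumBelow-comm zero    m p H = refl
  sumBlocks-sumBelow-comm (suc n) m p H =
    trans (cong₂ _+_ (sumBlocks-sumBelow-comm n m p _)
                     (trans (sumBelow-cong m (λ J → sumBlocks-sumBelow-comm n m p _)) (sumBelow-comm m p _)))
          (sym (sumBelow-distrib p _ _))

  decode : ∀ {n} → ℕ → Vec (Maybe ℕ) n → Vec ℕ n → Vec ℕ n
  decode p []      []      = []
  decode p (κ ∷ σ) (x ∷ t) = blockBase κ * p + x ∷ decode p σ t

  lookup-decode : ∀ {n} p (σ : Vec (Maybe ℕ) n) t i →
    V.lookup (decode p σ t) i ≡ blockBase (V.lookup σ i) * p + V.lookup t i
  lookup-decode p (κ ∷ σ) (x ∷ t) F.zero    = refl
  lookup-decode p (κ ∷ σ) (x ∷ t) (F.suc i) = lookup-decode p σ t i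

  inBox-blocks : ∀ {n} p (σ : Vec (Maybe ℕ) n) t → InBox (V.map (blockRange p) σ) t → ∀ i →
    V.lookup t i ≤ p × (0 < blockBase (V.lookup σ i) → 0 < V.lookup t i)
  inBox-blocks p (nothing ∷ σ) (x ∷ t) ((_ , x<1) , _)     F.zero    = ℕP.≤-trans (ℕP.≤-pred x<1) z≤n , λ ()
  inBox-blocks p (just J ∷ σ)  (x ∷ t) ((1≤x , x<1+p) , _) F.zero    = ℕP.≤-pred x<1+p , λ _ → 1≤x
  inBox-blocks p (κ ∷ σ)       (x ∷ t) (_ , t∈σ)           (F.suc i) = inBox-blocks p σ t t∈σ i

  sumBox-blocks : ∀ n m p (G : Vec ℕ n → ℕ) →
    sumBox (V.replicate n (0 , suc (m * p))) G ≡
    sumBlocks n m (λ σ → sumBox (V.map (blockRange p) σ) (G ∘ decode p σ))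
  sumBox-blocks zero    m p G = refl
  sumBox-blocks (suc n) m p G = begin
    h 0 + sumBelow (m * p) (h ∘ suc)
      ≡⟨ cong (h 0 +_) (sumBelow-* m p (h ∘ suc)) ⟩
    h 0 + sumBelow m (λ J → sumBelow p (λ i → h (suc (J * p + i))))
      ≡⟨ cong₂ _+_ (trans (blocks 0) (sumBlocks-cong n m (λ σ → sym (ℕP.+-identityʳ _))))
                   (sumBelow-cong m (λ J → trans (sumBelow-cong p (λ i →
                       trans (cong h (sym (ℕP.+-suc (J * p) i))) (blocks (J * p + suc i))))
                     (sym (sumBlocks-sumBelow-comm n m p _)))) ⟩
    sumBlocks (suc n) m (λ σ → sumBox (V.map (blockRange p) σ) (G ∘ decode p σ)) ∎
    where
    open ≡-Reasoning
    h : ℕ → ℕ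
    h x = sumBox (V.replicate n (0 , suc (m * p))) (G ∘ (x ∷_))
    blocks : ∀ x → h x ≡ sumBlocks n m (λ σ → sumBox (V.map (blockRange p) σ) (λ t → G (x ∷ decode p σ t)))
    blocks x = sumBox-blocks n m p (G ∘ (x ∷_))

  <ᵇ-true : ∀ {m n} → m < n → (m <ᵇ n) ≡ true
  <ᵇ-true {m} {n} = dec-true (m <? n)

  <ᵇ-false : ∀ {m n} → n ≤ m → (m <ᵇ n) ≡ false
  <ᵇ-false {m} {n} n≤m = dec-false (m <? n) (ℕP.≤⇒≯ n≤m)

  ≤ᵇ-true : ∀ {m n} → m ≤ n → (m ≤ᵇ n) ≡ true
  ≤ᵇ-true {m} {n} = dec-true (m ≤? n)

  ≤ᵇ-false : ∀ {m n} → n < m → (m ≤ᵇ n) ≡ false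
  ≤ᵇ-false {m} {n} n<m = dec-false (m ≤? n) (ℕP.<⇒≱ n<m)

  ≡ᵇ-true : ∀ n → (n ≡ᵇ n) ≡ true
  ≡ᵇ-true n = dec-true (n ℕ.≟ n) refl

  ≡ᵇ-false : ∀ {m n} → m ≢ n → (m ≡ᵇ n) ≡ false
  ≡ᵇ-false {m} {n} = dec-false (m ℕ.≟ n)

  ≤ᵇ≡<ᵇ-suc : ∀ m n → (m ≤ᵇ n) ≡ (m <ᵇ suc n)
  ≤ᵇ≡<ᵇ-suc zero    n = refl
  ≤ᵇ≡<ᵇ-suc (suc m) n = refl

  ≤ᵇ≡not-<ᵇ : ∀ m n → (n ≤ᵇ m) ≡ not (m <ᵇ n)
  ≤ᵇ≡not-<ᵇ zero    zero    = refl
  ≤ᵇ≡not-<ᵇ (suc m) zero    = refl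
  ≤ᵇ≡not-<ᵇ zero    (suc n) = refl
  ≤ᵇ≡not-<ᵇ (suc m) (suc n) = trans (sym (≤ᵇ≡<ᵇ-suc n m)) (≤ᵇ≡not-<ᵇ m n)

  <ᵇ-∸ : ∀ a x y → (a <ᵇ y ∸ x) ≡ (x + a <ᵇ y)
  <ᵇ-∸ a zero    y       = refl
  <ᵇ-∸ a (suc x) zero    = refl
  <ᵇ-∸ a (suc x) (suc y) = <ᵇ-∸ a x y

  ∸-≤ᵇ : ∀ c x y → (y ∸ x ≤ᵇ c) ≡ (y ≤ᵇ x + c)
  ∸-≤ᵇ c zero    y       = refl
  ∸-≤ᵇ c (suc x) zero    = refl
  ∸-≤ᵇ c (suc x) (suc y) = trans (∸-≤ᵇ c x y) (≤ᵇ≡<ᵇ-suc y (x + c))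

  +-cancelˡ-<ᵇ : ∀ a m n → (a + m <ᵇ a + n) ≡ (m <ᵇ n)
  +-cancelˡ-<ᵇ zero    m n = refl
  +-cancelˡ-<ᵇ (suc a) m n = +-cancelˡ-<ᵇ a m n

  +-cancelˡ-≤ᵇ : ∀ a m n → (a + m ≤ᵇ a + n) ≡ (m ≤ᵇ n)
  +-cancelˡ-≤ᵇ a m n = begin
    a + m ≤ᵇ a + n       ≡⟨ ≤ᵇ≡<ᵇ-suc (a + m) (a + n) ⟩
    a + m <ᵇ suc (a + n) ≡⟨ cong (a + m <ᵇ_) (sym (ℕP.+-suc a n)) ⟩
    a + m <ᵇ a + suc n   ≡⟨ +-cancelˡ-<ᵇ a m (suc n) ⟩
    m <ᵇ suc n           ≡⟨ sym (≤ᵇ≡<ᵇ-suc m n) ⟩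
    m ≤ᵇ n               ∎
    where open ≡-Reasoning

  -- Used with α = Ju + k for the block Ju of the lower colour, and c comparing the
  -- two offsets within their blocks (see inBand-blocks).
  blockBand : ℕ → ℕ → Bool → Bool
  blockBand α J c = ((J ≡ᵇ α) ∧ c) ∨ ((J ≡ᵇ suc α) ∧ not c)

  offset≤block : ∀ p J t → t ≤ p → J * p + t ≤ suc J * p
  offset≤block p J t t≤p = ℕP.≤-trans (ℕP.+-monoʳ-≤ (J * p) t≤p) (ℕP.≤-reflexive (ℕP.+-comm (J * p) p))

  lowerBlock≤ : ∀ p {J J′} t t′ → J < J′ → t ≤ p → J * p + t ≤ J′ * p + t′
  lowerBlock≤ p {J} {J′} t t′ J<J′ t≤p =
    ℕP.≤-trans (offset≤block p J t t≤p) (ℕP.≤-trans (ℕP.*-monoˡ-≤ p J<J′) (ℕP.m≤m+n (J′ * p) t′))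

  lowerBlock< : ∀ p {J J′} t t′ → J < J′ → t ≤ p → 0 < t′ → J * p + t < J′ * p + t′
  lowerBlock< p {J} {J′} t t′ J<J′ t≤p t′>0 =
    ℕP.≤-<-trans (offset≤block p J t t≤p) (ℕP.≤-<-trans (ℕP.*-monoˡ-≤ p J<J′) (ℕP.m<m+n (J′ * p) t′>0))

  band-blocks : ∀ p α J tu tv → tu ≤ p → tv ≤ p → (0 < J → 0 < tv) →
    ((α * p + tu <ᵇ J * p + tv) ∧ (J * p + tv ≤ᵇ suc α * p + tu)) ≡ blockBand α J (tu <ᵇ tv)
  band-blocks p α J tu tv tu≤p tv≤p tv>0 with ℕP.<-cmp J α
  ... | tri< J<α _ _
    rewrite <ᵇ-false (lowerBlock≤ p tv tu J<α tv≤p)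
          | ≡ᵇ-false (ℕP.<⇒≢ J<α) | ≡ᵇ-false (ℕP.<⇒≢ (ℕP.m<n⇒m<1+n J<α)) = refl
  ... | tri≈ _ refl _
    rewrite +-cancelˡ-<ᵇ (J * p) tu tv | ≤ᵇ-true (lowerBlock≤ p tv tu (ℕP.n<1+n J) tv≤p)
          | ≡ᵇ-true J | ≡ᵇ-false {J} {suc J} (ℕP.1+n≢n ∘ sym) =
    trans (BoolP.∧-identityʳ _) (sym (BoolP.∨-identityʳ _))
  ... | tri> _ _ α<J with ℕP.<-cmp J (suc α)
  ...   | tri< J<1+α _ _ = contradiction (ℕP.≤-pred J<1+α) (ℕP.<⇒≱ α<J)
  ...   | tri≈ _ refl _
    rewrite <ᵇ-true (lowerBlock< p tu tv α<J tu≤p (tv>0 (s≤s z≤n)))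
          | +-cancelˡ-≤ᵇ (J * p) tv tu | ≤ᵇ≡not-<ᵇ tu tv
          | ≡ᵇ-false {suc α} {α} ℕP.1+n≢n | ≡ᵇ-true J = refl
  ...   | tri> _ _ 1+α<J
    rewrite <ᵇ-true (lowerBlock< p tu tv α<J tu≤p (tv>0 (ℕP.≤-<-trans z≤n α<J)))
          | ≤ᵇ-false (lowerBlock< p tu tv 1+α<J tu≤p (tv>0 (ℕP.≤-<-trans z≤n α<J)))
          | ≡ᵇ-false (ℕP.>⇒≢ α<J) | ≡ᵇ-false (ℕP.>⇒≢ 1+α<J) = refl

  inBand-blocks : ∀ p k Ju Jv tu tv → tu ≤ p → tv ≤ p → (0 < Jv → 0 < tv) →
    does (inBand? p k ((Jv * p + tv) ∸ (Ju * p + tu))) ≡ blockBand (Ju + k) Jv (tu <ᵇ tv)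
  inBand-blocks p k Ju Jv tu tv tu≤p tv≤p tv>0 =
    trans (cong₂ _∧_ (trans (<ᵇ-∸ (k * p) (Ju * p + tu) (Jv * p + tv)) (cong (_<ᵇ Jv * p + tv) lower))
                     (trans (∸-≤ᵇ (suc k * p) (Ju * p + tu) (Jv * p + tv)) (cong (Jv * p + tv ≤ᵇ_) upper)))
          (band-blocks p (Ju + k) Jv tu tv tu≤p tv≤p tv>0)
    where
    open ℕSolver.+-*-Solver
    lower : Ju * p + tu + k * p ≡ (Ju + k) * p + tu
    lower = solve 4 (λ ju tu k p → ju :* p :+ tu :+ k :* p := (ju :+ k) :* p :+ tu) refl Ju tu k p
    upper : Ju * p + tu + suc k * p ≡ suc (Ju + k) * p + tu
    upper = solve 4 (λ ju tu k p → ju :* p :+ tu :+ (con 1 :+ k) :* p := (con 1 :+ ju :+ k) :* p :+ tu) refl Ju tu k p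

  -- Polynomials in p in the binomial basis

  choose : ℕ → ℕ → ℕ
  choose n       zero    = 1
  choose zero    (suc k) = 0
  choose (suc n) (suc k) = choose n k + choose n (suc k)

  [1+k]*pC[1+k]+k*pCk≡p*pCk : ∀ p k → suc k * choose p (suc k) + k * choose p k ≡ p * choose p k
  [1+k]*pC[1+k]+k*pCk≡p*pCk zero    zero    = refl
  [1+k]*pC[1+k]+k*pCk≡p*pCk zero    (suc k) = cong₂ _+_ (ℕP.*-zeroʳ (suc (suc k))) (ℕP.*-zeroʳ (suc k))
  [1+k]*pC[1+k]+k*pCk≡p*pCk (suc p) zero    =
    cong suc (trans (ℕP.+-identityʳ _) (trans (sym (ℕP.+-identityʳ _)) ([1+k]*pC[1+k]+k*pCk≡p*pCk p 0)))
  [1+k]*pC[1+k]+k*pCk≡p*pCk (suc p) (suc k) = begin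
    (2 + k) * (y + z) + (1 + k) * (x + y)
      ≡⟨ solve 4 (λ k x y z → (con 2 :+ k) :* (y :+ z) :+ (con 1 :+ k) :* (x :+ y)
                            := x :+ y :+ ((con 1 :+ k) :* y :+ k :* x) :+ ((con 2 :+ k) :* z :+ (con 1 :+ k) :* y))
               refl k x y z ⟩
    x + y + ((1 + k) * y + k * x) + ((2 + k) * z + (1 + k) * y)
      ≡⟨ cong₂ (λ u v → x + y + u + v) ([1+k]*pC[1+k]+k*pCk≡p*pCk p k) ([1+k]*pC[1+k]+k*pCk≡p*pCk p (suc k)) ⟩
    x + y + p * x + p * y
      ≡⟨ solve 3 (λ p x y → x :+ y :+ p :* x :+ p :* y := (con 1 :+ p) :* (x :+ y)) refl p x y ⟩
    (1 + p) * (x + y) ∎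
    where
    open ≡-Reasoning
    open ℕSolver.+-*-Solver
    x = choose p k
    y = choose p (suc k)
    z = choose p (suc (suc k))

  evalBinomial : ℕ → List ℕ → ℕ → ℕ
  evalBinomial k []       p = 0
  evalBinomial k (c ∷ cs) p = c * choose p k + evalBinomial (suc k) cs p

  BinomialPoly : (ℕ → ℕ) → Set
  BinomialPoly g = Σ (List ℕ) (λ cs → ∀ p → g p ≡ evalBinomial 0 cs p)

  addCoeffs : List ℕ → List ℕ → List ℕ
  addCoeffs []       ds       = ds
  addCoeffs (c ∷ cs) []       = c ∷ cs
  addCoeffs (c ∷ cs) (d ∷ ds) = c + d ∷ addCoeffs cs ds

  evalBinomial-addCoeffs : ∀ k cs ds p →
    evalBinomial k (addCoeffs cs ds) p ≡ evalBinomial k cs p + evalBinomial k ds p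
  evalBinomial-addCoeffs k []       ds       p = refl
  evalBinomial-addCoeffs k (c ∷ cs) []       p = sym (ℕP.+-identityʳ _)
  evalBinomial-addCoeffs k (c ∷ cs) (d ∷ ds) p =
    trans (cong₂ _+_ (ℕP.*-distribʳ-+ (choose p k) c d) (evalBinomial-addCoeffs (suc k) cs ds p))
          (interchange (c * choose p k) (d * choose p k) _ _)

  evalBinomial-pascal : ∀ k cs p →
    evalBinomial (suc k) cs (suc p) ≡ evalBinomial (suc k) cs p + evalBinomial k cs p
  evalBinomial-pascal k []       p = refl
  evalBinomial-pascal k (c ∷ cs) p =
    trans (cong₂ _+_ (trans (cong (c *_) (ℕP.+-comm (choose p k) (choose p (suc k))))
                            (ℕP.*-distribˡ-+ c (choose p (suc k)) (choose p k)))
                     (evalBinomial-pascal (suc k) cs p))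
          (interchange (c * choose p (suc k)) (c * choose p k) _ _)

  evalBinomial-zero : ∀ k cs → evalBinomial (suc k) cs 0 ≡ 0
  evalBinomial-zero k []       = refl
  evalBinomial-zero k (c ∷ cs) = cong₂ _+_ (ℕP.*-zeroʳ c) (evalBinomial-zero (suc k) cs)

  binomialPoly-cong : ∀ {g h} → (∀ p → g p ≡ h p) → BinomialPoly g → BinomialPoly h
  binomialPoly-cong g≗h (cs , g≡) = cs , λ p → trans (sym (g≗h p)) (g≡ p)

  binomialPoly-+ : ∀ {g h} → BinomialPoly g → BinomialPoly h → BinomialPoly (λ p → g p + h p)
  binomialPoly-+ (cs , g≡) (ds , h≡) =
    addCoeffs cs ds , λ p → trans (cong₂ _+_ (g≡ p) (h≡ p)) (sym (evalBinomial-addCoeffs 0 cs ds p))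

  binomialPoly-antidifference : ∀ {g h} → BinomialPoly h → (∀ p → g (suc p) ≡ g p + h p) → BinomialPoly g
  binomialPoly-antidifference {g} (cs , h≡) step = g 0 ∷ cs , go
    where
    go : ∀ p → g p ≡ g 0 * 1 + evalBinomial 1 cs p
    go zero    = sym (trans (cong₂ _+_ (ℕP.*-identityʳ (g 0)) (evalBinomial-zero 0 cs)) (ℕP.+-identityʳ (g 0)))
    go (suc p) = trans (step p) (trans (cong₂ _+_ (go p) (h≡ p))
      (trans (ℕP.+-assoc (g 0 * 1) _ _) (cong (g 0 * 1 +_) (sym (evalBinomial-pascal 0 cs p)))))

  binomialPoly-sumOver : ∀ {A : Set} (xs : List A) (g : A → ℕ → ℕ) →
    All (BinomialPoly ∘ g) xs → BinomialPoly (λ p → sumOver xs (λ x → g x p))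
  binomialPoly-sumOver []       g []         = [] , λ _ → refl
  binomialPoly-sumOver (x ∷ xs) g (gx ∷ gxs) = binomialPoly-+ gx (binomialPoly-sumOver xs g gxs)

  binomialPoly-sumBelow : ∀ m (g : ℕ → ℕ → ℕ) → (∀ J → BinomialPoly (g J)) →
    BinomialPoly (λ p → sumBelow m (λ J → g J p))
  binomialPoly-sumBelow zero    g poly = [] , λ _ → refl
  binomialPoly-sumBelow (suc m) g poly = binomialPoly-+ (poly 0) (binomialPoly-sumBelow m (g ∘ suc) (poly ∘ suc))

  binomialPoly-sumBlocks : ∀ n m (g : Vec (Maybe ℕ) n → ℕ → ℕ) → (∀ σ → BinomialPoly (g σ)) →
    BinomialPoly (λ p → sumBlocks n m (λ σ → g σ p))
  binomialPoly-sumBlocks zero    m g poly = poly []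
  binomialPoly-sumBlocks (suc n) m g poly = binomialPoly-+
    (binomialPoly-sumBlocks n m (g ∘ (nothing ∷_)) (poly ∘ (nothing ∷_)))
    (binomialPoly-sumBelow m (λ J p → sumBlocks n m (λ σ → g (just J ∷ σ) p))
       (λ J → binomialPoly-sumBlocks n m (g ∘ (just J ∷_)) (poly ∘ (just J ∷_))))

  -- Sums of order-invariant functions over boxes

  SameOrder : ∀ {n} → Vec ℕ n → Vec ℕ n → Set
  SameOrder t t′ = ∀ i j → (V.lookup t i <ᵇ V.lookup t j) ≡ (V.lookup t′ i <ᵇ V.lookup t′ j)

  OrderInvariant : ∀ {n} → (Vec ℕ n → ℕ) → Set
  OrderInvariant G = ∀ t t′ → SameOrder t t′ → G t ≡ G t′

  data Kind : Set where
    origin : Kind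
    free   : Kind
    above  : ℕ → Kind

  kindRange : ℕ → Kind → ℕ × ℕ
  kindRange p origin    = (0 , 1)
  kindRange p free      = (1 , p)
  kindRange p (above ℓ) = (suc (p + ℓ) , 1)

  kindBox : ∀ {n} → ℕ → Vec Kind n → Vec (ℕ × ℕ) n
  kindBox p = V.map (kindRange p)

  raise : ∀ {n} → Vec Kind n → Vec Kind n
  raise []            = []
  raise (origin ∷ τ)  = origin ∷ raise τ
  raise (free ∷ τ)    = free ∷ raise τ
  raise (above ℓ ∷ τ) = above (suc ℓ) ∷ raise τ

  -- A free coordinate of box p + 1 lies either in [1, p] or at p + 1, which is level
  -- `above 0` of box p (and `above ℓ` of box p + 1 is `above (suc ℓ)` of box p).
  -- `raise τ` is the choice promoting no coordinate, `promotions τ` lists the others.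
  promotions : ∀ {n} → Vec Kind n → List (Vec Kind n)
  promotions []            = []
  promotions (origin ∷ τ)  = L.map (origin ∷_) (promotions τ)
  promotions (above ℓ ∷ τ) = L.map (above (suc ℓ) ∷_) (promotions τ)
  promotions (free ∷ τ)    = L.map (free ∷_) (promotions τ) ++ L.map (above 0 ∷_) (raise τ ∷ promotions τ)

  freeCount : ∀ {n} → Vec Kind n → ℕ
  freeCount []            = 0
  freeCount (origin ∷ τ)  = freeCount τ
  freeCount (free ∷ τ)    = suc (freeCount τ)
  freeCount (above _ ∷ τ) = freeCount τ

  freeCount-raise : ∀ {n} (τ : Vec Kind n) → freeCount (raise τ) ≡ freeCount τ
  freeCount-raise []            = refl
  freeCount-raise (origin ∷ τ)  = freeCount-raise τ
  freeCount-raise (free ∷ τ)    = cong suc (freeCount-raise τ)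
  freeCount-raise (above _ ∷ τ) = freeCount-raise τ

  freeCount-promotions : ∀ {n} (τ : Vec Kind n) → All (λ τ′ → freeCount τ′ < freeCount τ) (promotions τ)
  freeCount-promotions []            = []
  freeCount-promotions (origin ∷ τ)  = ListAllP.map⁺ (freeCount-promotions τ)
  freeCount-promotions (above ℓ ∷ τ) = ListAllP.map⁺ (freeCount-promotions τ)
  freeCount-promotions (free ∷ τ)    = ListAllP.++⁺ (ListAllP.map⁺ (ListAll.map s≤s (freeCount-promotions τ)))
    (ListAllP.map⁺ (s≤s (ℕP.≤-reflexive (freeCount-raise τ)) ∷ ListAll.map ℕP.m≤n⇒m≤1+n (freeCount-promotions τ)))

  splits : ∀ {n} → Vec Kind n → List (Vec Kind n)
  splits τ = raise τ ∷ promotions τ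

  sumOver-splits-fixed : ∀ {n} p κ (τ : Vec Kind n) s G → kindRange p κ ≡ (s , 1) →
    sumOver (L.map (κ ∷_) (splits τ)) (λ τ′ → sumBox (kindBox p τ′) G) ≡
    sumOver (splits τ) (λ τ′ → sumBox (kindBox p τ′) (λ t → G (s ∷ t)))
  sumOver-splits-fixed p κ τ s G κ≡s = trans (sumOver-map (κ ∷_) (splits τ) _)
    (sumOver-cong (splits τ) (λ τ′ → trans (cong (λ r → sumBox (r ∷ kindBox p τ′) G) κ≡s)
                                           (sumBox-singleton s (kindBox p τ′) G)))

  sumBox-kindBox-suc : ∀ {n} p (τ : Vec Kind n) G →
    sumBox (kindBox (suc p) τ) G ≡ sumOver (splits τ) (λ τ′ → sumBox (kindBox p τ′) G)
  sumBox-kindBox-suc p [] G = sym (ℕP.+-identityʳ (G []))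
  sumBox-kindBox-suc p (origin ∷ τ) G =
    trans (sumBox-singleton 0 (kindBox (suc p) τ) G)
          (trans (sumBox-kindBox-suc p τ _) (sym (sumOver-splits-fixed p origin τ 0 G refl)))
  sumBox-kindBox-suc p (above ℓ ∷ τ) G =
    trans (sumBox-singleton (suc (suc (p + ℓ))) (kindBox (suc p) τ) G)
          (trans (sumBox-kindBox-suc p τ _)
                 (sym (sumOver-splits-fixed p (above (suc ℓ)) τ _ G (cong (λ x → suc x , 1) (ℕP.+-suc p ℓ)))))
  sumBox-kindBox-suc p (free ∷ τ) G = begin
    sumBelow (suc p) (λ i → box (suc p) τ (suc i))
      ≡⟨ sumBelow-suc p _ ⟩
    sumBelow p (λ i → box (suc p) τ (suc i)) + box (suc p) τ (suc p)
      ≡⟨ cong₂ _+_ (sumBelow-cong p (λ i → sumBox-kindBox-suc p τ _)) (sumBox-kindBox-suc p τ _) ⟩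
    sumBelow p (λ i → sumOver (splits τ) (λ τ′ → box p τ′ (suc i))) + sumOver (splits τ) (λ τ′ → box p τ′ (suc p))
      ≡⟨ cong₂ _+_ (trans (sym (sumOver-sumBelow-comm (splits τ) p _))
                          (sym (sumOver-map (free ∷_) (splits τ) (λ τ′ → sumBox (kindBox p τ′) G))))
                   (sym (sumOver-splits-fixed p (above 0) τ (suc p) G (cong (λ x → suc x , 1) (ℕP.+-identityʳ p)))) ⟩
    sumOver (L.map (free ∷_) (splits τ)) (λ τ′ → sumBox (kindBox p τ′) G)
      + sumOver (L.map (above 0 ∷_) (splits τ)) (λ τ′ → sumBox (kindBox p τ′) G)
      ≡⟨ sym (sumOver-++ (L.map (free ∷_) (splits τ)) _ (λ τ′ → sumBox (kindBox p τ′) G)) ⟩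
    sumOver (splits (free ∷ τ)) (λ τ′ → sumBox (kindBox p τ′) G) ∎
    where
    open ≡-Reasoning
    box : ℕ → Vec Kind _ → ℕ → ℕ
    box q τ′ x = sumBox (kindBox q τ′) (λ t → G (x ∷ t))

  skip : ℕ → ℕ → ℕ
  skip p x = if x ≤ᵇ p then x else suc x

  skip-≤ : ∀ {p x} → x ≤ p → skip p x ≡ x
  skip-≤ x≤p rewrite ≤ᵇ-true x≤p = refl

  skip-> : ∀ {p x} → p < x → skip p x ≡ suc x
  skip-> p<x rewrite ≤ᵇ-false p<x = refl

  skip-<ᵇ : ∀ p x y → (skip p x <ᵇ skip p y) ≡ (x <ᵇ y)
  skip-<ᵇ p x y with x ≤? p | y ≤? p
  ... | yes x≤p | yes y≤p rewrite skip-≤ x≤p | skip-≤ y≤p = refl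
  ... | no  x≰p | no  y≰p rewrite skip-> (ℕP.≰⇒> x≰p) | skip-> (ℕP.≰⇒> y≰p) = refl
  ... | yes x≤p | no  y≰p rewrite skip-≤ x≤p | skip-> (ℕP.≰⇒> y≰p) =
    trans (<ᵇ-true (ℕP.m<n⇒m<1+n x<y)) (sym (<ᵇ-true x<y))
    where x<y = ℕP.≤-<-trans x≤p (ℕP.≰⇒> y≰p)
  ... | no  x≰p | yes y≤p rewrite skip-> (ℕP.≰⇒> x≰p) | skip-≤ y≤p =
    trans (<ᵇ-false (ℕP.<⇒≤ y<1+x)) (sym (<ᵇ-false (ℕP.<⇒≤ y<x)))
    where
    y<x = ℕP.≤-<-trans y≤p (ℕP.≰⇒> x≰p)
    y<1+x = ℕP.m<n⇒m<1+n y<x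

  sameOrder-skip : ∀ {n} p (t : Vec ℕ n) → SameOrder (V.map (skip p) t) t
  sameOrder-skip p t i j =
    trans (cong₂ _<ᵇ_ (VecP.lookup-map i (skip p) t) (VecP.lookup-map j (skip p) t))
          (skip-<ᵇ p (V.lookup t i) (V.lookup t j))

  sumBox-raise : ∀ {n} p (τ : Vec Kind n) G →
    sumBox (kindBox p (raise τ)) G ≡ sumBox (kindBox p τ) (G ∘ V.map (skip p))
  sumBox-raise p []           G = refl
  sumBox-raise p (origin ∷ τ) G = cong (_+ 0) (sumBox-raise p τ _)
  sumBox-raise p (free ∷ τ)   G = sumBelow-cong< p (λ i i<p → trans (sumBox-raise p τ _)
    (sumBox-cong (kindBox p τ) (λ t → cong (λ x → G (x ∷ V.map (skip p) t)) (sym (skip-≤ i<p)))))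
  sumBox-raise p (above ℓ ∷ τ) G = begin
    sumBox ((suc (p + suc ℓ) , 1) ∷ kindBox p (raise τ)) G
      ≡⟨ sumBox-singleton (suc (p + suc ℓ)) (kindBox p (raise τ)) G ⟩
    sumBox (kindBox p (raise τ)) (λ t → G (suc (p + suc ℓ) ∷ t))
      ≡⟨ sumBox-raise p τ _ ⟩
    sumBox (kindBox p τ) (λ t → G (suc (p + suc ℓ) ∷ V.map (skip p) t))
      ≡⟨ sumBox-cong (kindBox p τ) (λ t → cong (λ x → G (x ∷ V.map (skip p) t)) level) ⟩
    sumBox (kindBox p τ) (λ t → G (skip p (suc (p + ℓ)) ∷ V.map (skip p) t))
      ≡⟨ sym (sumBox-singleton (suc (p + ℓ)) (kindBox p τ) (G ∘ V.map (skip p))) ⟩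
    sumBox (kindBox p (above ℓ ∷ τ)) (G ∘ V.map (skip p)) ∎
    where
    open ≡-Reasoning
    level : suc (p + suc ℓ) ≡ skip p (suc (p + ℓ))
    level = trans (cong suc (ℕP.+-suc p ℓ)) (sym (skip-> (s≤s (ℕP.m≤m+n p ℓ))))

  -- The forward difference in p is a sum over the promotions, which have fewer free
  -- coordinates: raise τ contributes the value at p because skip p preserves the order.
  binomialPoly-sumBox : ∀ {n} (G : Vec ℕ n → ℕ) → OrderInvariant G → ∀ τ →
    BinomialPoly (λ p → sumBox (kindBox p τ) G)
  binomialPoly-sumBox G invariant τ = go (suc (freeCount τ)) τ ℕP.≤-refl
    where
    count : Vec Kind _ → ℕ → ℕ
    count τ p = sumBox (kindBox p τ) G
    difference : ∀ τ p → count τ (suc p) ≡ count τ p + sumOver (promotions τ) (λ τ′ → count τ′ p)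
    difference τ p = trans (sumBox-kindBox-suc p τ G) (cong (_+ sumOver (promotions τ) (λ τ′ → count τ′ p))
      (trans (sumBox-raise p τ G) (sumBox-cong (kindBox p τ) (λ t → invariant _ t (sameOrder-skip p t)))))
    go : ∀ fuel τ → freeCount τ < fuel → BinomialPoly (count τ)
    go (suc fuel) τ (s≤s τ<fuel) = binomialPoly-antidifference
      (binomialPoly-sumOver (promotions τ) count
        (ListAll.map (λ {τ′} τ′<τ → go fuel τ′ (ℕP.<-≤-trans τ′<τ τ<fuel)) (freeCount-promotions τ)))
      (difference τ)

  blockKind : Maybe ℕ → Kind
  blockKind nothing  = origin
  blockKind (just _) = free

  blockRange≡kindRange : ∀ {n} p (σ : Vec (Maybe ℕ) n) → V.map (blockRange p) σ ≡ kindBox p (V.map blockKind σ)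
  blockRange≡kindRange p []            = refl
  blockRange≡kindRange p (nothing ∷ σ) = cong ((0 , 1) ∷_) (blockRange≡kindRange p σ)
  blockRange≡kindRange p (just _ ∷ σ)  = cong ((1 , p) ∷_) (blockRange≡kindRange p σ)

  module ArcExponents (D : Digraph) where

    BandTest : Set
    BandTest = ℕ → Fin (nV D) → Fin (nV D) → Bool

    arcCount : (Fin (nV D) → Fin (nV D) → Bool) → ℕ
    arcCount β = sumOver (arcs D) (indicator ∘ uncurry β)

    hasExponents : ∀ m → BandTest → Vec ℕ m → Vec ℕ m → ℕ
    hasExponents m β a b = indicator (does (V.tabulate (λ k → arcCount (β (toℕ k))) ≟V a)
                                    ∧ does (V.tabulate (λ k → arcCount (flip (β (toℕ k)))) ≟V b))

    hasExponents-cong : ∀ m {β β′ : BandTest} a b → (∀ k u v → β k u v ≡ β′ k u v) →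
      hasExponents m β a b ≡ hasExponents m β′ a b
    hasExponents-cong m a b eq = cong₂ (λ x y → indicator (does (x ≟V a) ∧ does (y ≟V b)))
      (VecP.tabulate-cong (λ k → sumOver-cong (arcs D) (λ (u , v) → cong indicator (eq (toℕ k) u v))))
      (VecP.tabulate-cong (λ k → sumOver-cong (arcs D) (λ (u , v) → cong indicator (eq (toℕ k) v u))))

    colourBand : ℕ → Vec ℕ (nV D) → BandTest
    colourBand p t k u v = does (inBand? p k (V.lookup t v ∸ V.lookup t u))

    countRHS≡sumBox : ∀ m p a b →
      countRHS D m p a b ≡ sumBox (V.replicate (nV D) (0 , suc (m * p))) (λ t → hasExponents m (colourBand p t) a b)
    countRHS≡sumBox m p a b =
      trans (length-filter≡sumOver _ (allFuns (nV D) (suc (m * p))))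
      (trans (sumOver-cong (allFuns (nV D) (suc (m * p))) (λ f →
                cong₂ (λ x y → indicator (does (x ≟V a) ∧ does (y ≟V b))) (forward f) (backward f)))
             (sumOver-allFuns (nV D) (suc (m * p)) (λ t → hasExponents m (colourBand p t) a b)))
      where
      colour : ∀ {N} (f : Vec (Fin N) (nV D)) u → toℕ (V.lookup f u) ≡ V.lookup (V.map toℕ f) u
      colour f u = sym (VecP.lookup-map u toℕ f)
      forward : ∀ f → expPlus D m p f ≡ V.tabulate (λ k → arcCount (colourBand p (V.map toℕ f) (toℕ k)))
      forward f = VecP.tabulate-cong (λ k → trans (length-filter≡sumOver _ (arcs D)) (sumOver-cong (arcs D)
        (λ (u , v) → cong (λ d → indicator (does (inBand? p (toℕ k) d))) (cong₂ _∸_ (colour f v) (colour f u)))))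
      backward : ∀ f → expMinus D m p f ≡ V.tabulate (λ k → arcCount (flip (colourBand p (V.map toℕ f) (toℕ k))))
      backward f = VecP.tabulate-cong (λ k → trans (length-filter≡sumOver _ (arcs D)) (sumOver-cong (arcs D)
        (λ (u , v) → cong (λ d → indicator (does (inBand? p (toℕ k) d))) (cong₂ _∸_ (colour f u) (colour f v)))))

    blockColourBand : Vec (Maybe ℕ) (nV D) → Vec ℕ (nV D) → BandTest
    blockColourBand σ t k u v =
      blockBand (blockBase (V.lookup σ u) + k) (blockBase (V.lookup σ v)) (V.lookup t u <ᵇ V.lookup t v)

    colourBand-decode : ∀ p σ t → InBox (V.map (blockRange p) σ) t → ∀ k u v →
      colourBand p (decode p σ t) k u v ≡ blockColourBand σ t k u v
    colourBand-decode p σ t t∈σ k u v =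
      trans (cong (λ d → does (inBand? p k d)) (cong₂ _∸_ (lookup-decode p σ t v) (lookup-decode p σ t u)))
            (inBand-blocks p k (blockBase (V.lookup σ u)) (blockBase (V.lookup σ v)) (V.lookup t u) (V.lookup t v)
               (proj₁ (inBox-blocks p σ t t∈σ u)) (proj₁ (inBox-blocks p σ t t∈σ v)) (proj₂ (inBox-blocks p σ t t∈σ v)))

    blockWeight : ∀ m → Vec ℕ m → Vec ℕ m → Vec (Maybe ℕ) (nV D) → Vec ℕ (nV D) → ℕ
    blockWeight m a b σ t = hasExponents m (blockColourBand σ t) a b

    blockWeight-invariant : ∀ m a b σ → OrderInvariant (blockWeight m a b σ)
    blockWeight-invariant m a b σ t t′ same = hasExponents-cong m a b (λ k u v →
      cong (blockBand (blockBase (V.lookup σ u) + k) (blockBase (V.lookup σ v))) (same u v))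

    countRHS≡sumBlocks : ∀ m p a b → countRHS D m p a b ≡
      sumBlocks (nV D) m (λ σ → sumBox (kindBox p (V.map blockKind σ)) (blockWeight m a b σ))
    countRHS≡sumBlocks m p a b =
      trans (countRHS≡sumBox m p a b)
      (trans (sumBox-blocks (nV D) m p _)
             (sumBlocks-cong (nV D) m (λ σ →
               trans (sumBox-congᵢ (V.map (blockRange p) σ) (λ t t∈σ →
                        hasExponents-cong m a b (colourBand-decode p σ t t∈σ)))
                     (cong (λ r → sumBox r (blockWeight m a b σ)) (blockRange≡kindRange p σ)))))

    countRHS-binomialPoly : ∀ m a b → BinomialPoly (λ p → countRHS D m p a b)
    countRHS-binomialPoly m a b = binomialPoly-cong (λ p → sym (countRHS≡sumBlocks m p a b))
      (binomialPoly-sumBlocks (nV D) m _ (λ σ →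
        binomialPoly-sumBox (blockWeight m a b σ) (blockWeight-invariant m a b σ) (V.map blockKind σ)))

open Counting

module Interpolation where

  open import Data.Rational using (_+_; _*_; _-_; -_)
  open ℚSolver.+-*-Solver

  -- ℕ→ℚ n = n / 1 goes through normalisation; its normal form fromℕ n is a literal
  -- mkℚ, on which ℚ addition and multiplication compute.
  fromℕ : ℕ → ℚ
  fromℕ n = mkℚ (ℤ.+ n) 0 (∣1⇒≡1 ∘′ proj₂)

  ℕ→ℚ≡fromℕ : ∀ n → ℕ→ℚ n ≡ fromℕ n
  ℕ→ℚ≡fromℕ n = ℚP.normalize-coprime (∣1⇒≡1 ∘′ proj₂)

  ℕ→ℚ-+ : ∀ a b → ℕ→ℚ (a ℕ.+ b) ≡ ℕ→ℚ a + ℕ→ℚ b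
  ℕ→ℚ-+ a b = begin
    ℤ.+ (a ℕ.+ b) ℚ./ 1
      ≡⟨ cong (ℚ._/ 1) (sym (cong₂ ℤ._+_ (ℤP.*-identityʳ (ℤ.+ a)) (ℤP.*-identityʳ (ℤ.+ b)))) ⟩
    (ℤ.+ a ℤ.* ℤ.+ 1 ℤ.+ ℤ.+ b ℤ.* ℤ.+ 1) ℚ./ 1
      ≡⟨⟩
    fromℕ a + fromℕ b
      ≡⟨ sym (cong₂ _+_ (ℕ→ℚ≡fromℕ a) (ℕ→ℚ≡fromℕ b)) ⟩
    ℕ→ℚ a + ℕ→ℚ b ∎
    where open ≡-Reasoning

  ℕ→ℚ-* : ∀ a b → ℕ→ℚ (a ℕ.* b) ≡ ℕ→ℚ a * ℕ→ℚ b
  ℕ→ℚ-* a b = begin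
    ℤ.+ (a ℕ.* b) ℚ./ 1     ≡⟨ cong (ℚ._/ 1) (ℤP.pos-* a b) ⟩
    (ℤ.+ a ℤ.* ℤ.+ b) ℚ./ 1 ≡⟨⟩
    fromℕ a * fromℕ b       ≡⟨ sym (cong₂ _*_ (ℕ→ℚ≡fromℕ a) (ℕ→ℚ≡fromℕ b)) ⟩
    ℕ→ℚ a * ℕ→ℚ b           ∎
    where open ≡-Reasoning

  ℕ→ℚ-injective : ∀ {a b} → ℕ→ℚ a ≡ ℕ→ℚ b → a ≡ b
  ℕ→ℚ-injective {a} {b} eq =
    ℤP.+-injective (cong ℚ.ℚ.numerator (trans (sym (ℕ→ℚ≡fromℕ a)) (trans eq (ℕ→ℚ≡fromℕ b))))

  1/suc : ℕ → ℚ
  1/suc n = 1/ fromℕ (suc n)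

  1/suc-inverse : ∀ n → 1/suc n * ℕ→ℚ (suc n) ≡ 1ℚ
  1/suc-inverse n = trans (cong (1/suc n *_) (ℕ→ℚ≡fromℕ (suc n))) (ℚP.*-inverseˡ (fromℕ (suc n)))

  evalPoly : List ℚ → ℚ → ℚ
  evalPoly []       x = 0ℚ
  evalPoly (c ∷ cs) x = c + x * evalPoly cs x

  addPoly : List ℚ → List ℚ → List ℚ
  addPoly []       ds       = ds
  addPoly (c ∷ cs) []       = c ∷ cs
  addPoly (c ∷ cs) (d ∷ ds) = c + d ∷ addPoly cs ds

  scalePoly : ℚ → List ℚ → List ℚ
  scalePoly c = L.map (c *_)

  linearTimes : ℚ → ℚ → List ℚ → List ℚ
  linearTimes α β cs = addPoly (scalePoly α cs) (0ℚ ∷ scalePoly β cs)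

  evalPoly-addPoly : ∀ cs ds x → evalPoly (addPoly cs ds) x ≡ evalPoly cs x + evalPoly ds x
  evalPoly-addPoly []       ds       x = sym (ℚP.+-identityˡ _)
  evalPoly-addPoly (c ∷ cs) []       x = sym (ℚP.+-identityʳ _)
  evalPoly-addPoly (c ∷ cs) (d ∷ ds) x = trans (cong (λ e → c + d + x * e) (evalPoly-addPoly cs ds x))
    (solve 5 (λ c d x u v → c :+ d :+ x :* (u :+ v) := (c :+ x :* u) :+ (d :+ x :* v)) refl
           c d x (evalPoly cs x) (evalPoly ds x))

  evalPoly-scalePoly : ∀ a cs x → evalPoly (scalePoly a cs) x ≡ a * evalPoly cs x
  evalPoly-scalePoly a []       x = sym (ℚP.*-zeroʳ a)
  evalPoly-scalePoly a (c ∷ cs) x = trans (cong (λ e → a * c + x * e) (evalPoly-scalePoly a cs x))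
    (solve 4 (λ a c x u → a :* c :+ x :* (a :* u) := a :* (c :+ x :* u)) refl a c x (evalPoly cs x))

  evalPoly-linearTimes : ∀ α β cs x → evalPoly (linearTimes α β cs) x ≡ (α + β * x) * evalPoly cs x
  evalPoly-linearTimes α β cs x = begin
    evalPoly (linearTimes α β cs) x
      ≡⟨ evalPoly-addPoly (scalePoly α cs) (0ℚ ∷ scalePoly β cs) x ⟩
    evalPoly (scalePoly α cs) x + (0ℚ + x * evalPoly (scalePoly β cs) x)
      ≡⟨ cong₂ (λ u v → u + (0ℚ + x * v)) (evalPoly-scalePoly α cs x) (evalPoly-scalePoly β cs x) ⟩
    α * e + (0ℚ + x * (β * e))
      ≡⟨ solve 4 (λ α β x e → α :* e :+ (con 0ℚ :+ x :* (β :* e)) := (α :+ β :* x) :* e) refl α β x e ⟩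
    (α + β * x) * e ∎
    where
    open ≡-Reasoning
    e = evalPoly cs x

  -- For X = C(p, k + 1), Y = C(p, k), K = k, P = p, M = m, iM = 1/m and c = 1/(k + 1):
  -- the recurrence (k + 1) X + k Y = p Y, solved for X in terms of q = 1 + m p.
  choose-suc-in-q : ∀ X Y K P M iM c → iM * M ≡ 1ℚ → c * (1ℚ + K) ≡ 1ℚ → (1ℚ + K) * X + K * Y ≡ P * Y →
    X ≡ ((- iM - K) * c + iM * c * (1ℚ + M * P)) * Y
  choose-suc-in-q X Y K P M iM c iM*M≡1 c*[1+K]≡1 recurrence = begin
    X                                    ≡⟨ sym (ℚP.*-identityˡ X) ⟩
    1ℚ * X                               ≡⟨ cong (_* X) (sym c*[1+K]≡1) ⟩
    c * (1ℚ + K) * X                     ≡⟨ solve 4 (λ X Y K c → c :* (con 1ℚ :+ K) :* X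
                                              := c :* ((con 1ℚ :+ K) :* X :+ K :* Y) :- c :* (K :* Y)) refl X Y K c ⟩
    c * ((1ℚ + K) * X + K * Y) - c * (K * Y) ≡⟨ cong (λ z → c * z - c * (K * Y)) recurrence ⟩
    c * (P * Y) - c * (K * Y)            ≡⟨ solve 4 (λ Y K P c → c :* (P :* Y) :- c :* (K :* Y)
                                              := c :* (P :* Y) :* con 1ℚ :- c :* (K :* Y)) refl Y K P c ⟩
    c * (P * Y) * 1ℚ - c * (K * Y)       ≡⟨ cong (λ z → c * (P * Y) * z - c * (K * Y)) (sym iM*M≡1) ⟩
    c * (P * Y) * (iM * M) - c * (K * Y) ≡⟨ solve 6 (λ Y K P M iM c → c :* (P :* Y) :* (iM :* M) :- c :* (K :* Y)
                                              := ((:- iM :- K) :* c :+ iM :* c :* (con 1ℚ :+ M :* P)) :* Y)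
                                            refl Y K P M iM c ⟩
    ((- iM - K) * c + iM * c * (1ℚ + M * P)) * Y ∎
    where open ≡-Reasoning

  module ChooseInQ (m′ : ℕ) where

    q : ℕ → ℚ
    q p = ℕ→ℚ (suc (suc m′ ℕ.* p))

    q-injective : ∀ {s p} → s < p → q p ≢ q s
    q-injective s<p qp≡qs = ℕP.<⇒≢ s<p (sym (ℕP.*-cancelˡ-≡ _ _ (suc m′) (ℕP.suc-injective (ℕ→ℚ-injective qp≡qs))))

    -- C(p, k + 1) = (stepConst k + stepSlope k q) C(p, k), since p - k = (q - 1 - m k) / m.
    stepConst stepSlope : ℕ → ℚ
    stepConst k = (- 1/suc m′ - ℕ→ℚ k) * 1/suc k
    stepSlope k = 1/suc m′ * 1/suc k

    chooseInQ : ℕ → List ℚ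
    chooseInQ zero    = 1ℚ ∷ []
    chooseInQ (suc k) = linearTimes (stepConst k) (stepSlope k) (chooseInQ k)

    evalPoly-chooseInQ : ∀ k p → evalPoly (chooseInQ k) (q p) ≡ ℕ→ℚ (choose p k)
    evalPoly-chooseInQ zero    p = trans (cong (1ℚ +_) (ℚP.*-zeroʳ (q p))) (ℚP.+-identityʳ 1ℚ)
    evalPoly-chooseInQ (suc k) p = begin
      evalPoly (chooseInQ (suc k)) (q p)
        ≡⟨ evalPoly-linearTimes (stepConst k) (stepSlope k) (chooseInQ k) (q p) ⟩
      ((- 1/suc m′ - K) * 1/suc k + 1/suc m′ * 1/suc k * q p) * evalPoly (chooseInQ k) (q p)
        ≡⟨ cong₂ (λ u v → ((- 1/suc m′ - K) * 1/suc k + 1/suc m′ * 1/suc k * u) * v) q≡1+mp (evalPoly-chooseInQ k p) ⟩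
      ((- 1/suc m′ - K) * 1/suc k + 1/suc m′ * 1/suc k * (1ℚ + ℕ→ℚ (suc m′) * P)) * ℕ→ℚ (choose p k)
        ≡⟨ sym (choose-suc-in-q X (ℕ→ℚ (choose p k)) K P (ℕ→ℚ (suc m′)) (1/suc m′) (1/suc k)
                  (1/suc-inverse m′) c*[1+K]≡1 recurrence) ⟩
      X ∎
      where
      open ≡-Reasoning
      X = ℕ→ℚ (choose p (suc k))
      K = ℕ→ℚ k
      P = ℕ→ℚ p
      q≡1+mp : q p ≡ 1ℚ + ℕ→ℚ (suc m′) * P
      q≡1+mp = trans (ℕ→ℚ-+ 1 (suc m′ ℕ.* p)) (cong (1ℚ +_) (ℕ→ℚ-* (suc m′) p))
      c*[1+K]≡1 : 1/suc k * (1ℚ + K) ≡ 1ℚ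
      c*[1+K]≡1 = trans (cong (1/suc k *_) (sym (ℕ→ℚ-+ 1 k))) (1/suc-inverse k)
      recurrence : (1ℚ + K) * X + K * ℕ→ℚ (choose p k) ≡ P * ℕ→ℚ (choose p k)
      recurrence = begin
        (1ℚ + K) * X + K * ℕ→ℚ (choose p k)
          ≡⟨ cong₂ _+_ (trans (cong (_* X) (sym (ℕ→ℚ-+ 1 k))) (sym (ℕ→ℚ-* (suc k) (choose p (suc k)))))
                       (sym (ℕ→ℚ-* k (choose p k))) ⟩
        ℕ→ℚ (suc k ℕ.* choose p (suc k)) + ℕ→ℚ (k ℕ.* choose p k)
          ≡⟨ sym (ℕ→ℚ-+ (suc k ℕ.* choose p (suc k)) (k ℕ.* choose p k)) ⟩
        ℕ→ℚ (suc k ℕ.* choose p (suc k) ℕ.+ k ℕ.* choose p k)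
          ≡⟨ cong ℕ→ℚ ([1+k]*pC[1+k]+k*pCk≡p*pCk p k) ⟩
        ℕ→ℚ (p ℕ.* choose p k)
          ≡⟨ ℕ→ℚ-* p (choose p k) ⟩
        P * ℕ→ℚ (choose p k) ∎

    binomialInQ : ℕ → List ℕ → List ℚ
    binomialInQ k []       = []
    binomialInQ k (c ∷ cs) = addPoly (scalePoly (ℕ→ℚ c) (chooseInQ k)) (binomialInQ (suc k) cs)

    evalPoly-binomialInQ : ∀ k cs p → evalPoly (binomialInQ k cs) (q p) ≡ ℕ→ℚ (evalBinomial k cs p)
    evalPoly-binomialInQ k []       p = refl
    evalPoly-binomialInQ k (c ∷ cs) p = begin
      evalPoly (binomialInQ k (c ∷ cs)) (q p)
        ≡⟨ evalPoly-addPoly (scalePoly (ℕ→ℚ c) (chooseInQ k)) (binomialInQ (suc k) cs) (q p) ⟩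
      evalPoly (scalePoly (ℕ→ℚ c) (chooseInQ k)) (q p) + evalPoly (binomialInQ (suc k) cs) (q p)
        ≡⟨ cong₂ _+_ (trans (evalPoly-scalePoly (ℕ→ℚ c) (chooseInQ k) (q p)) (cong (ℕ→ℚ c *_) (evalPoly-chooseInQ k p)))
                     (evalPoly-binomialInQ (suc k) cs p) ⟩
      ℕ→ℚ c * ℕ→ℚ (choose p k) + ℕ→ℚ (evalBinomial (suc k) cs p)
        ≡⟨ cong (_+ ℕ→ℚ (evalBinomial (suc k) cs p)) (sym (ℕ→ℚ-* c (choose p k))) ⟩
      ℕ→ℚ (c ℕ.* choose p k) + ℕ→ℚ (evalBinomial (suc k) cs p)
        ≡⟨ sym (ℕ→ℚ-+ (c ℕ.* choose p k) (evalBinomial (suc k) cs p)) ⟩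
      ℕ→ℚ (evalBinomial k (c ∷ cs) p) ∎
      where open ≡-Reasoning

  -- Existence of B

  sumℚ : ∀ {A : Set} → List A → (A → ℚ) → ℚ
  sumℚ []       h = 0ℚ
  sumℚ (x ∷ xs) h = h x + sumℚ xs h

  module _ {A : Set} where

    sumℚ-cong : ∀ (xs : List A) {g h : A → ℚ} → (∀ x → g x ≡ h x) → sumℚ xs g ≡ sumℚ xs h
    sumℚ-cong []       eq = refl
    sumℚ-cong (x ∷ xs) eq = cong₂ _+_ (eq x) (sumℚ-cong xs eq)

    sumℚ-zero : ∀ (xs : List A) → sumℚ xs (λ _ → 0ℚ) ≡ 0ℚ
    sumℚ-zero []       = refl
    sumℚ-zero (x ∷ xs) = trans (cong (0ℚ +_) (sumℚ-zero xs)) (ℚP.+-identityˡ 0ℚ)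

    sumℚ-++ : ∀ (xs ys : List A) h → sumℚ (xs ++ ys) h ≡ sumℚ xs h + sumℚ ys h
    sumℚ-++ []       ys h = sym (ℚP.+-identityˡ _)
    sumℚ-++ (x ∷ xs) ys h = trans (cong (h x +_) (sumℚ-++ xs ys h)) (sym (ℚP.+-assoc (h x) _ _))

    sumℚ-map : ∀ {B : Set} (f : B → A) xs h → sumℚ (L.map f xs) h ≡ sumℚ xs (h ∘ f)
    sumℚ-map f []       h = refl
    sumℚ-map f (x ∷ xs) h = cong (h (f x) +_) (sumℚ-map f xs h)

    sumℚ-concatMap : ∀ {B : Set} (f : B → List A) xs h → sumℚ (L.concatMap f xs) h ≡ sumℚ xs (λ x → sumℚ (f x) h)
    sumℚ-concatMap f []       h = refl
    sumℚ-concatMap f (x ∷ xs) h =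
      trans (sumℚ-++ (f x) (L.concatMap f xs) h) (cong (sumℚ (f x) h +_) (sumℚ-concatMap f xs h))

    sumℚ-if : ∀ b (xs : List A) h → sumℚ xs (λ x → if b then h x else 0ℚ) ≡ (if b then sumℚ xs h else 0ℚ)
    sumℚ-if true  xs h = refl
    sumℚ-if false xs h = sumℚ-zero xs

  if-∧ : ∀ b c (x : ℚ) → (if b ∧ c then x else 0ℚ) ≡ (if b then (if c then x else 0ℚ) else 0ℚ)
  if-∧ true  c x = refl
  if-∧ false c x = refl

  if-+ : ∀ b (x y : ℚ) → (if b then x else 0ℚ) + (if b then y else 0ℚ) ≡ (if b then x + y else 0ℚ)
  if-+ true  x y = refl
  if-+ false x y = ℚP.+-identityˡ 0ℚ

  module _ {m : ℕ} where

    matches : Vec ℕ m → Vec ℕ m → Vec ℕ m → Vec ℕ m → Bool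
    matches a b a′ b′ = does (a ≟V a′) ∧ does (b ≟V b′)

    coeffAt-∷ : ∀ c i a b (P : Poly m) x a′ b′ →
      coeffAt ((c , (i , a , b)) ∷ P) x a′ b′ ≡ (if matches a b a′ b′ then c * (x ^Q i) else 0ℚ) + coeffAt P x a′ b′
    coeffAt-∷ c i a b P x a′ b′ with a ≟V a′ | b ≟V b′
    ... | yes _ | yes _ = refl
    ... | yes _ | no _  = sym (ℚP.+-identityˡ _)
    ... | no _  | _     = sym (ℚP.+-identityˡ _)

    coeffAt-++ : ∀ (P Q : Poly m) x a b → coeffAt (P ++ Q) x a b ≡ coeffAt P x a b + coeffAt Q x a b
    coeffAt-++ []                      Q x a b = sym (ℚP.+-identityˡ _)
    coeffAt-++ ((c , (i , a′ , b′)) ∷ P) Q x a b = begin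
      coeffAt ((c , (i , a′ , b′)) ∷ P ++ Q) x a b
        ≡⟨ coeffAt-∷ c i a′ b′ (P ++ Q) x a b ⟩
      t + coeffAt (P ++ Q) x a b
        ≡⟨ cong (t +_) (coeffAt-++ P Q x a b) ⟩
      t + (coeffAt P x a b + coeffAt Q x a b)
        ≡⟨ sym (ℚP.+-assoc t _ _) ⟩
      t + coeffAt P x a b + coeffAt Q x a b
        ≡⟨ cong (_+ coeffAt Q x a b) (sym (coeffAt-∷ c i a′ b′ P x a b)) ⟩
      coeffAt ((c , (i , a′ , b′)) ∷ P) x a b + coeffAt Q x a b ∎
      where
      open ≡-Reasoning
      t = if matches a′ b′ a b then c * (x ^Q i) else 0ℚ

    coeffAt-concatMap : ∀ {A : Set} (f : A → Poly m) xs x a b →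
      coeffAt (L.concatMap f xs) x a b ≡ sumℚ xs (λ y → coeffAt (f y) x a b)
    coeffAt-concatMap f []       x a b = refl
    coeffAt-concatMap f (y ∷ ys) x a b =
      trans (coeffAt-++ (f y) (L.concatMap f ys) x a b) (cong (coeffAt (f y) x a b +_) (coeffAt-concatMap f ys x a b))

    monomials : ℕ → List ℚ → Vec ℕ m → Vec ℕ m → Poly m
    monomials i []       a b = []
    monomials i (c ∷ cs) a b = (c , (i , a , b)) ∷ monomials (suc i) cs a b

    coeffAt-monomials : ∀ i cs a b x a′ b′ →
      coeffAt (monomials i cs a b) x a′ b′ ≡ (if matches a b a′ b′ then x ^Q i * evalPoly cs x else 0ℚ)
    coeffAt-monomials i []       a b x a′ b′ with matches a b a′ b′
    ... | true  = sym (ℚP.*-zeroʳ (x ^Q i))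
    ... | false = refl
    coeffAt-monomials i (c ∷ cs) a b x a′ b′ =
      trans (coeffAt-∷ c i a b (monomials (suc i) cs a b) x a′ b′)
      (trans (cong ((if matches a b a′ b′ then c * (x ^Q i) else 0ℚ) +_) (coeffAt-monomials (suc i) cs a b x a′ b′))
      (trans (if-+ (matches a b a′ b′) (c * (x ^Q i)) (x * (x ^Q i) * evalPoly cs x))
             (cong (if matches a b a′ b′ then_else 0ℚ)
               (solve 4 (λ c xi x e → c :* xi :+ x :* xi :* e := xi :* (c :+ x :* e)) refl c (x ^Q i) x (evalPoly cs x)))))

  range : ℕ → ℕ → List ℕ
  range s zero    = []
  range s (suc n) = s ∷ range (suc s) n

  boundedVecs : (m L : ℕ) → List (Vec ℕ m)
  boundedVecs zero    L = [] ∷ []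
  boundedVecs (suc m) L = L.concatMap (λ y → L.map (y ∷_) (boundedVecs m L)) (range 0 (suc L))

  sumℚ-range-∉ : ∀ s n a (h : ℕ → ℚ) → a < s ⊎ s ℕ.+ n ≤ a →
    sumℚ (range s n) (λ y → if does (y ℕ.≟ a) then h y else 0ℚ) ≡ 0ℚ
  sumℚ-range-∉ s zero    a h a∉ = refl
  sumℚ-range-∉ s (suc n) a h a∉ with s ℕ.≟ a
  ... | yes refl = contradiction a∉ Sum.[ ℕP.<-irrefl refl , ℕP.<⇒≱ (ℕP.m<m+n s (s≤s z≤n)) ]
  ... | no  s≢a rewrite ≡ᵇ-false s≢a = trans (ℚP.+-identityˡ _)
    (sumℚ-range-∉ (suc s) n a h (Sum.map ℕP.m<n⇒m<1+n (ℕP.≤-trans (ℕP.≤-reflexive (sym (ℕP.+-suc s n)))) a∉))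

  sumℚ-range-∈ : ∀ s n a (h : ℕ → ℚ) → s ≤ a → a < s ℕ.+ n →
    sumℚ (range s n) (λ y → if does (y ℕ.≟ a) then h y else 0ℚ) ≡ h a
  sumℚ-range-∈ s zero    a h s≤a a<s+0 =
    contradiction (ℕP.<-≤-trans a<s+0 (ℕP.≤-trans (ℕP.≤-reflexive (ℕP.+-identityʳ s)) s≤a)) (ℕP.<-irrefl refl)
  sumℚ-range-∈ s (suc n) a h s≤a a<s+n with s ℕ.≟ a
  ... | yes refl rewrite ≡ᵇ-true s =
    trans (cong (h s +_) (sumℚ-range-∉ (suc s) n s h (inj₁ (ℕP.n<1+n s)))) (ℚP.+-identityʳ (h s))
  ... | no  s≢a rewrite ≡ᵇ-false s≢a = trans (ℚP.+-identityˡ _)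
    (sumℚ-range-∈ (suc s) n a h (ℕP.≤∧≢⇒< s≤a s≢a) (ℕP.<-≤-trans a<s+n (ℕP.≤-reflexive (ℕP.+-suc s n))))

  sumℚ-boundedVecs-select : ∀ m L a (h : Vec ℕ m → ℚ) → (¬ VecAll.All (_≤ L) a → h a ≡ 0ℚ) →
    sumℚ (boundedVecs m L) (λ a′ → if does (a′ ≟V a) then h a′ else 0ℚ) ≡ h a
  sumℚ-boundedVecs-select zero    L [] h _ = ℚP.+-identityʳ (h [])
  sumℚ-boundedVecs-select (suc m) L (y ∷ a) h unbounded = begin
    sumℚ (boundedVecs (suc m) L) (λ a′ → if does (a′ ≟V (y ∷ a)) then h a′ else 0ℚ)
      ≡⟨ sumℚ-concatMap (λ y′ → L.map (y′ ∷_) (boundedVecs m L)) (range 0 (suc L)) _ ⟩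
    sumℚ (range 0 (suc L)) (λ y′ → sumℚ (L.map (y′ ∷_) (boundedVecs m L))
                                        (λ a′ → if does (a′ ≟V (y ∷ a)) then h a′ else 0ℚ))
      ≡⟨ sumℚ-cong (range 0 (suc L)) (λ y′ → trans (sumℚ-map (y′ ∷_) (boundedVecs m L) _)
           (trans (sumℚ-cong (boundedVecs m L) (λ a′ → if-∧ (does (y′ ℕ.≟ y)) (does (a′ ≟V a)) (h (y′ ∷ a′))))
                  (sumℚ-if (does (y′ ℕ.≟ y)) (boundedVecs m L) _))) ⟩
    sumℚ (range 0 (suc L)) (λ y′ → if does (y′ ℕ.≟ y) then tail y′ else 0ℚ)
      ≡⟨ head-selected ⟩
    h (y ∷ a) ∎
    where
    open ≡-Reasoning
    tail : ℕ → ℚ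
    tail y′ = sumℚ (boundedVecs m L) (λ a′ → if does (a′ ≟V a) then h (y′ ∷ a′) else 0ℚ)
    head-selected : sumℚ (range 0 (suc L)) (λ y′ → if does (y′ ℕ.≟ y) then tail y′ else 0ℚ) ≡ h (y ∷ a)
    head-selected with y ≤? L
    ... | yes y≤L = trans (sumℚ-range-∈ 0 (suc L) y tail z≤n (s≤s y≤L))
                          (sumℚ-boundedVecs-select m L a (h ∘ (y ∷_)) (λ a-unb → unbounded (a-unb ∘ VecAll.tail)))
    ... | no  y≰L = trans (sumℚ-range-∉ 0 (suc L) y tail (inj₂ (ℕP.≰⇒> y≰L))) (sym (unbounded (y≰L ∘ VecAll.head)))

  module Construction (D : Digraph) (m′ : ℕ) where
    open ChooseInQ m′
    open ArcExponents D using (countRHS-binomialPoly)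

    m : ℕ
    m = suc m′

    arcTotal : ℕ
    arcTotal = L.length (arcs D)

    expPlus-bounded : ∀ {N} p (f : Vec (Fin N) (nV D)) → VecAll.All (_≤ arcTotal) (expPlus D m p f)
    expPlus-bounded p f = VecAllP.tabulate⁺ {f = λ k → fPlus D p f (toℕ k)} (λ k → LP.length-filter _ (arcs D))

    expMinus-bounded : ∀ {N} p (f : Vec (Fin N) (nV D)) → VecAll.All (_≤ arcTotal) (expMinus D m p f)
    expMinus-bounded p f = VecAllP.tabulate⁺ {f = λ k → fMinus D p f (toℕ k)} (λ k → LP.length-filter _ (arcs D))

    countRHS-unbounded : ∀ p a b → ¬ (VecAll.All (_≤ arcTotal) a × VecAll.All (_≤ arcTotal) b) →
      countRHS D m p a b ≡ 0
    countRHS-unbounded p a b unbounded =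
      cong L.length (LP.filter-none (λ f → (expPlus D m p f ≟V a) ×-dec (expMinus D m p f ≟V b))
                                    (ListAll.universal excluded (allFuns (nV D) (suc (m ℕ.* p)))))
      where
      excluded : ∀ f → ¬ (expPlus D m p f ≡ a × expMinus D m p f ≡ b)
      excluded f (plus≡a , minus≡b) = unbounded ( subst (VecAll.All (_≤ arcTotal)) plus≡a (expPlus-bounded p f)
                                                , subst (VecAll.All (_≤ arcTotal)) minus≡b (expMinus-bounded p f))

    coefficients : Vec ℕ m → Vec ℕ m → List ℚ
    coefficients a b = binomialInQ 0 (proj₁ (countRHS-binomialPoly m a b))

    evalPoly-coefficients : ∀ p a b → evalPoly (coefficients a b) (q p) ≡ ℕ→ℚ (countRHS D m p a b)
    evalPoly-coefficients p a b = trans (evalPoly-binomialInQ 0 (proj₁ (countRHS-binomialPoly m a b)) p)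
                                        (cong ℕ→ℚ (sym (proj₂ (countRHS-binomialPoly m a b) p)))

    B : Poly m
    B = L.concatMap (λ a → L.concatMap (λ b → monomials 0 (coefficients a b) a b) (boundedVecs m arcTotal))
                    (boundedVecs m arcTotal)

    B-isB : IsB D m B
    B-isB p a b = begin
      coeffAt B (q p) a b
        ≡⟨ coeffAt-concatMap _ (boundedVecs m arcTotal) (q p) a b ⟩
      sumℚ (boundedVecs m arcTotal) (λ a′ → coeffAt (L.concatMap (λ b′ → monomials 0 (coefficients a′ b′) a′ b′)
                                                                   (boundedVecs m arcTotal)) (q p) a b)
        ≡⟨ sumℚ-cong (boundedVecs m arcTotal) (λ a′ →
             trans (coeffAt-concatMap _ (boundedVecs m arcTotal) (q p) a b)
             (trans (sumℚ-cong (boundedVecs m arcTotal) (λ b′ →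
                      trans (coeffAt-monomials 0 (coefficients a′ b′) a′ b′ (q p) a b)
                            (if-∧ (does (a′ ≟V a)) (does (b′ ≟V b)) _)))
                    (sumℚ-if (does (a′ ≟V a)) (boundedVecs m arcTotal) _))) ⟩
      sumℚ (boundedVecs m arcTotal) (λ a′ → if does (a′ ≟V a) then value a′ else 0ℚ)
        ≡⟨ sumℚ-boundedVecs-select m arcTotal a value
             (λ a-unb → trans (value≡ a) (cong ℕ→ℚ (countRHS-unbounded p a b (a-unb ∘ proj₁)))) ⟩
      value a
        ≡⟨ value≡ a ⟩
      ℕ→ℚ (countRHS D m p a b) ∎
      where
      open ≡-Reasoning
      value : Vec ℕ m → ℚ
      value a′ = sumℚ (boundedVecs m arcTotal)
                      (λ b′ → if does (b′ ≟V b) then 1ℚ * evalPoly (coefficients a′ b′) (q p) else 0ℚ)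
      value≡ : ∀ a′ → value a′ ≡ ℕ→ℚ (countRHS D m p a′ b)
      value≡ a′ = trans (sumℚ-boundedVecs-select m arcTotal b _
                          (λ b-unb → trans (ℚP.*-identityˡ _) (trans (evalPoly-coefficients p a′ b)
                            (cong ℕ→ℚ (countRHS-unbounded p a′ b (b-unb ∘ proj₂))))))
                        (trans (ℚP.*-identityˡ _) (evalPoly-coefficients p a′ b))

  -- Uniqueness of B

  evalPoly-applyUpTo-zero : ∀ N (f : ℕ → ℚ) x → (∀ i → f i ≡ 0ℚ) → evalPoly (L.applyUpTo f N) x ≡ 0ℚ
  evalPoly-applyUpTo-zero zero    f x f≡0 = refl
  evalPoly-applyUpTo-zero (suc N) f x f≡0 =
    trans (cong₂ (λ u v → u + x * v) (f≡0 0) (evalPoly-applyUpTo-zero N (f ∘ suc) x (f≡0 ∘ suc)))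
          (solve 1 (λ x → con 0ℚ :+ x :* con 0ℚ := con 0ℚ) refl x)

  evalPoly-applyUpTo-cong : ∀ N {f g : ℕ → ℚ} x → (∀ i → f i ≡ g i) →
    evalPoly (L.applyUpTo f N) x ≡ evalPoly (L.applyUpTo g N) x
  evalPoly-applyUpTo-cong zero    x f≗g = refl
  evalPoly-applyUpTo-cong (suc N) x f≗g =
    cong₂ (λ u v → u + x * v) (f≗g 0) (evalPoly-applyUpTo-cong N x (f≗g ∘ suc))

  evalPoly-applyUpTo-+ : ∀ N (f g : ℕ → ℚ) x →
    evalPoly (L.applyUpTo (λ i → f i + g i) N) x ≡ evalPoly (L.applyUpTo f N) x + evalPoly (L.applyUpTo g N) x
  evalPoly-applyUpTo-+ zero    f g x = sym (ℚP.+-identityˡ 0ℚ)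
  evalPoly-applyUpTo-+ (suc N) f g x =
    trans (cong (λ v → f 0 + g 0 + x * v) (evalPoly-applyUpTo-+ N (f ∘ suc) (g ∘ suc) x))
          (solve 5 (λ a b x u v → a :+ b :+ x :* (u :+ v) := (a :+ x :* u) :+ (b :+ x :* v)) refl (f 0) (g 0) x _ _)

  evalPoly-applyUpTo-- : ∀ N (f g : ℕ → ℚ) x →
    evalPoly (L.applyUpTo (λ i → f i - g i) N) x ≡ evalPoly (L.applyUpTo f N) x - evalPoly (L.applyUpTo g N) x
  evalPoly-applyUpTo-- zero    f g x = solve 0 (con 0ℚ := con 0ℚ :- con 0ℚ) refl
  evalPoly-applyUpTo-- (suc N) f g x =
    trans (cong (λ v → f 0 - g 0 + x * v) (evalPoly-applyUpTo-- N (f ∘ suc) (g ∘ suc) x))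
          (solve 5 (λ a b x u v → a :- b :+ x :* (u :- v) := (a :+ x :* u) :- (b :+ x :* v)) refl (f 0) (g 0) x _ _)

  evalPoly-applyUpTo-δ : ∀ N i c x → i < N →
    evalPoly (L.applyUpTo (λ j → if does (i ℕ.≟ j) then c else 0ℚ) N) x ≡ c * (x ^Q i)
  evalPoly-applyUpTo-δ (suc N) zero     c x _ =
    trans (cong (λ v → c + x * v) (evalPoly-applyUpTo-zero N _ x (λ _ → refl)))
          (solve 2 (λ c x → c :+ x :* con 0ℚ := c :* con 1ℚ) refl c x)
  evalPoly-applyUpTo-δ (suc N) (suc i) c x (s≤s i<N) =
    trans (cong (λ v → 0ℚ + x * v) (evalPoly-applyUpTo-δ N i c x i<N))
          (solve 3 (λ c x y → con 0ℚ :+ x :* (c :* y) := c :* (x :* y)) refl c x (x ^Q i))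

  module _ {m : ℕ} where

    coeff-∷ : ∀ c i a b (P : Poly m) j a′ b′ →
      coeff ((c , (i , a , b)) ∷ P) (j , a′ , b′) ≡
      (if matches a b a′ b′ then (if does (i ℕ.≟ j) then c else 0ℚ) else 0ℚ) + coeff P (j , a′ , b′)
    coeff-∷ c i a b P j a′ b′ with i ℕ.≟ j | a ≟V a′ | b ≟V b′
    ... | yes refl | yes _ | yes _ rewrite ≡ᵇ-true i    = refl
    ... | no  i≢j  | yes _ | yes _ rewrite ≡ᵇ-false i≢j = sym (ℚP.+-identityˡ _)
    ... | yes refl | yes _ | no _  = sym (ℚP.+-identityˡ _)
    ... | no  _    | yes _ | no _  = sym (ℚP.+-identityˡ _)
    ... | yes refl | no _  | _     = sym (ℚP.+-identityˡ _)
    ... | no  _    | no _  | _     = sym (ℚP.+-identityˡ _)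

    coefficientList : Poly m → Vec ℕ m → Vec ℕ m → ℕ → List ℚ
    coefficientList P a b = L.applyUpTo (λ i → coeff P (i , a , b))

    ExponentsBelow : ℕ → Poly m → Set
    ExponentsBelow N = All (λ (_ , i , _) → i < N)

    degreeBound : Poly m → ℕ
    degreeBound []                  = 0
    degreeBound ((_ , (i , _)) ∷ P) = suc i ℕ.+ degreeBound P

    exponentsBelow-degreeBound : ∀ (P : Poly m) {N} → degreeBound P ≤ N → ExponentsBelow N P
    exponentsBelow-degreeBound []                  _ = []
    exponentsBelow-degreeBound ((_ , (i , _)) ∷ P) P≤N =
      ℕP.≤-trans (ℕP.m≤m+n (suc i) (degreeBound P)) P≤N
        ∷ exponentsBelow-degreeBound P (ℕP.≤-trans (ℕP.m≤n+m (degreeBound P) (suc i)) P≤N)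

    coeffAt≡evalPoly : ∀ N (P : Poly m) x a b → ExponentsBelow N P → coeffAt P x a b ≡ evalPoly (coefficientList P a b N) x
    coeffAt≡evalPoly N []                      x a b [] = sym (evalPoly-applyUpTo-zero N _ x (λ _ → refl))
    coeffAt≡evalPoly N ((c , (i , a′ , b′)) ∷ P) x a b (i<N ∷ P<N) = begin
      coeffAt ((c , (i , a′ , b′)) ∷ P) x a b
        ≡⟨ coeffAt-∷ c i a′ b′ P x a b ⟩
      (if matches a′ b′ a b then c * (x ^Q i) else 0ℚ) + coeffAt P x a b
        ≡⟨ cong₂ _+_ (sym (term (matches a′ b′ a b))) (coeffAt≡evalPoly N P x a b P<N) ⟩
      evalPoly (L.applyUpTo δ N) x + evalPoly (coefficientList P a b N) x
        ≡⟨ sym (evalPoly-applyUpTo-+ N δ (λ j → coeff P (j , a , b)) x) ⟩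
      evalPoly (L.applyUpTo (λ j → δ j + coeff P (j , a , b)) N) x
        ≡⟨ evalPoly-applyUpTo-cong N x (λ j → sym (coeff-∷ c i a′ b′ P j a b)) ⟩
      evalPoly (coefficientList ((c , (i , a′ , b′)) ∷ P) a b N) x ∎
      where
      open ≡-Reasoning
      δ : ℕ → ℚ
      δ j = if matches a′ b′ a b then (if does (i ℕ.≟ j) then c else 0ℚ) else 0ℚ
      term : ∀ d → evalPoly (L.applyUpTo (λ j → if d then (if does (i ℕ.≟ j) then c else 0ℚ) else 0ℚ) N) x
                   ≡ (if d then c * (x ^Q i) else 0ℚ)
      term true  = evalPoly-applyUpTo-δ N i c x i<N
      term false = evalPoly-applyUpTo-zero N _ x (λ _ → refl)

  -- quotient r es lists the coefficients of (P(x) - P(r)) / (x - r) for P = c ∷ es.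
  quotient : ℚ → List ℚ → List ℚ
  quotient r []       = []
  quotient r (e ∷ es) = evalPoly (e ∷ es) r ∷ quotient r es

  length-quotient : ∀ r es → L.length (quotient r es) ≡ L.length es
  length-quotient r []       = refl
  length-quotient r (e ∷ es) = cong suc (length-quotient r es)

  evalPoly-quotient : ∀ c es x r → evalPoly (c ∷ es) x ≡ evalPoly (c ∷ es) r + (x - r) * evalPoly (quotient r es) x
  evalPoly-quotient c []       x r =
    solve 3 (λ c x r → c :+ x :* con 0ℚ := (c :+ r :* con 0ℚ) :+ (x :- r) :* con 0ℚ) refl c x r
  evalPoly-quotient c (e ∷ es) x r = trans (cong (λ z → c + x * z) (evalPoly-quotient e es x r))
    (solve 5 (λ c x r Pr Q → c :+ x :* (Pr :+ (x :- r) :* Q) := (c :+ r :* Pr) :+ (x :- r) :* (Pr :+ x :* Q)) refl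
       c x r (evalPoly (e ∷ es) r) (evalPoly (quotient r es) x))

  evalPoly-allZero : ∀ cs x → All (_≡ 0ℚ) cs → evalPoly cs x ≡ 0ℚ
  evalPoly-allZero []       x []           = refl
  evalPoly-allZero (c ∷ cs) x (c≡0 ∷ cs≡0) = trans (cong₂ (λ u v → u + x * v) c≡0 (evalPoly-allZero cs x cs≡0))
    (solve 1 (λ x → con 0ℚ :+ x :* con 0ℚ := con 0ℚ) refl x)

  head≡0 : ∀ c cs r → All (_≡ 0ℚ) cs → evalPoly (c ∷ cs) r ≡ 0ℚ → c ≡ 0ℚ
  head≡0 c cs r cs≡0 root = begin
    c                     ≡⟨ solve 2 (λ c r → c := c :+ r :* con 0ℚ) refl c r ⟩
    c + r * 0ℚ            ≡⟨ cong (λ z → c + r * z) (sym (evalPoly-allZero cs r cs≡0)) ⟩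
    evalPoly (c ∷ cs) r   ≡⟨ root ⟩
    0ℚ                    ∎
    where open ≡-Reasoning

  allZero-quotient : ∀ r es → All (_≡ 0ℚ) (quotient r es) → All (_≡ 0ℚ) es
  allZero-quotient r []       _            = []
  allZero-quotient r (e ∷ es) (root ∷ q≡0) = head≡0 e es r es≡0 root ∷ es≡0
    where es≡0 = allZero-quotient r es q≡0

  *-zero-cancelˡ : ∀ a b → a ≢ 0ℚ → a * b ≡ 0ℚ → b ≡ 0ℚ
  *-zero-cancelˡ a b a≢0 ab≡0 = begin
    b                 ≡⟨ sym (ℚP.*-identityˡ b) ⟩
    1ℚ * b            ≡⟨ cong (_* b) (sym (ℚP.*-inverseˡ a)) ⟩
    1/ a * a * b      ≡⟨ ℚP.*-assoc (1/ a) a b ⟩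
    1/ a * (a * b)    ≡⟨ cong (1/ a *_) ab≡0 ⟩
    1/ a * 0ℚ         ≡⟨ ℚP.*-zeroʳ (1/ a) ⟩
    0ℚ                ∎
    where
    open ≡-Reasoning
    instance _ = ℚ.≢-nonZero a≢0

  module _ (x : ℕ → ℚ) (x-injective : ∀ {s p} → s < p → x p ≢ x s) where

    allZero-vanishing : ∀ cs s → (∀ p → s ≤ p → evalPoly cs (x p) ≡ 0ℚ) → All (_≡ 0ℚ) cs
    allZero-vanishing cs = go (L.length cs) cs ℕP.≤-refl
      where
      go : ∀ fuel cs → L.length cs ≤ fuel → ∀ s → (∀ p → s ≤ p → evalPoly cs (x p) ≡ 0ℚ) → All (_≡ 0ℚ) cs
      go _          []       _             s vanishes = []
      go (suc fuel) (c ∷ es) (s≤s es≤fuel) s vanishes = head≡0 c es (x s) es≡0 (vanishes s ℕP.≤-refl) ∷ es≡0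
        where
        quotient-vanishes : ∀ p → suc s ≤ p → evalPoly (quotient (x s) es) (x p) ≡ 0ℚ
        quotient-vanishes p s<p = *-zero-cancelˡ (x p - x s) _
          (x-injective s<p ∘ x∙y⁻¹≈ε⇒x≈y (x p) (x s))
          (trans (sym (ℚP.+-identityˡ _))
            (trans (cong (_+ ((x p - x s) * evalPoly (quotient (x s) es) (x p))) (sym (vanishes s ℕP.≤-refl)))
              (trans (sym (evalPoly-quotient c es (x p) (x s))) (vanishes p (ℕP.<⇒≤ s<p)))))
        es≡0 : All (_≡ 0ℚ) es
        es≡0 = allZero-quotient (x s) es (go fuel (quotient (x s) es)
                 (ℕP.≤-trans (ℕP.≤-reflexive (length-quotient (x s) es)) es≤fuel) (suc s) quotient-vanishes)

    ≈P-from-coeffAt : ∀ {m} (P Q : Poly m) → (∀ p a b → coeffAt P (x p) a b ≡ coeffAt Q (x p) a b) → P ≈P Q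
    ≈P-from-coeffAt P Q agree (j , a , b) =
      x∙y⁻¹≈ε⇒x≈y (coeff P (j , a , b)) (coeff Q (j , a , b)) (ListAll.lookup differences≡0 (∈-applyUpTo⁺ _ j<N))
      where
      N : ℕ
      N = degreeBound P ℕ.+ degreeBound Q ℕ.+ suc j
      j<N : j < N
      j<N = ℕP.m≤n+m (suc j) _
      P<N : ExponentsBelow N P
      P<N = exponentsBelow-degreeBound P (ℕP.≤-trans (ℕP.m≤m+n _ (degreeBound Q)) (ℕP.m≤m+n _ (suc j)))
      Q<N : ExponentsBelow N Q
      Q<N = exponentsBelow-degreeBound Q (ℕP.≤-trans (ℕP.m≤n+m _ (degreeBound P)) (ℕP.m≤m+n _ (suc j)))
      difference : ℕ → ℚ
      difference i = coeff P (i , a , b) - coeff Q (i , a , b)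
      difference-vanishes : ∀ p → 0 ≤ p → evalPoly (L.applyUpTo difference N) (x p) ≡ 0ℚ
      difference-vanishes p _ = begin
        evalPoly (L.applyUpTo difference N) (x p)
          ≡⟨ evalPoly-applyUpTo-- N _ _ (x p) ⟩
        evalPoly (coefficientList P a b N) (x p) - evalPoly (coefficientList Q a b N) (x p)
          ≡⟨ cong₂ _-_ (sym (coeffAt≡evalPoly N P (x p) a b P<N)) (sym (coeffAt≡evalPoly N Q (x p) a b Q<N)) ⟩
        coeffAt P (x p) a b - coeffAt Q (x p) a b
          ≡⟨ cong (_- coeffAt Q (x p) a b) (agree p a b) ⟩
        coeffAt Q (x p) a b - coeffAt Q (x p) a b
          ≡⟨ ℚP.+-inverseʳ (coeffAt Q (x p) a b) ⟩
        0ℚ ∎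
        where open ≡-Reasoning
      differences≡0 : All (_≡ 0ℚ) (L.applyUpTo difference N)
      differences≡0 = allZero-vanishing (L.applyUpTo difference N) 0 difference-vanishes

open Interpolation

theorem9p1 : (m : ℕ) → m ≥ 1 → (D : Digraph) →
    Σ (Poly m) (λ B → IsB D m B × ((B' : Poly m) → IsB D m B' → B' ≈P B))
theorem9p1 (suc m′) _ D =
  B , B-isB , λ B′ B′-isB → ≈P-from-coeffAt q q-injective B′ B (λ p a b → trans (B′-isB p a b) (sym (B-isB p a b)))
  where
  open ChooseInQ m′
  open Construction D m′
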